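{- Let $F$ be a field of characteristic zero, $f$ an anti-involution of $F^\times$, and $\Phi_f(C_n)=(C_n,F^\times,\varphi,f)$ a skew gain graph whose underlying graph is the cycle $C=C_n$ on $n\ge 3$ vertices. Then $$\Psi(\Phi_f(C_n),x)=x^n+\sum_{k=1}^{\lfloor n/2\rfloor}(-1)^k a_{2k}x^{n-2k}-\big(\varphi(C)+f(\varphi(C))\big),\qquad a_{2k}=\sum_{M\in\mathcal{M}_k(C_n)}\prod_{e\in M}g(\varphi(e)).$$
   Context: An anti-involution of $F^\times$ is a map $f:F^\times\to F^\times$ with $f(f(x))=x$ and $f(xy)=f(y)f(x)$. A skew gain graph $(G,F^\times,\varphi,f)$ is a simple graph $G$ with vertices $v_1,\dots,v_n$ and a function $\varphi$ on oriented edges (both orientations of each edge) with values in $F^\times$ satisfying $\varphi(\overrightarrow{vu})=f(\varphi(\overrightarrow{uv}))$. Its adjacency matrix $A$ has $(i,j)$ entry $\varphi(\overrightarrow{v_iv_j})$ if $v_i\sim v_j$ and $0$ otherwise, and $\Psi(\cdot,x)=\det(xI-A)$. $g(x)=xf(x)$, and for an edge $e=uv$, $g(\varphi(e))$ means $g(\varphi(\overrightarrow{uv}))$ (which equals $g(\varphi(\overrightarrow{vu}))$). For the cycle $C:v_0v_1\cdots v_{n-1}v_0$, $\varphi(C)=\varphi(\overrightarrow{v_0v_1})\cdots\varphi(\overrightarrow{v_{n-1}v_0})$. $\mathcal{M}_k(G)$ is the set of matchings of $G$ with exactly $k$ edges. -}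

module Defs where

open import Level using (Level; _⊔_)
open import Algebra.Bundles using (CommutativeRing)
open import Data.Nat as ℕ using (ℕ; zero; suc; _≤_)
open import Data.Nat.DivMod using (_/_)
open import Data.Nat.DivMod using (_mod_)
open import Data.Fin using (Fin; zero; suc; toℕ; punchIn)
open import Data.Fin.Properties using (_≟_)
open import Data.Fin.Subset using (Subset; inside; outside; ∣_∣)
open import Data.Vec using (Vec; []; _∷_; lookup)
open import Data.Bool using (Bool; true; false; if_then_else_; _∧_; _∨_; not)
open import Data.List using (List; []; _∷_; _++_; map; foldr; filterᵇ; upTo)
open import Data.Product using (_×_; Σ)
open import Relation.Nullary using (¬_; does)
open import Relation.Binary.PropositionalEquality using (_≡_)

next : ∀ {n} → Fin n → Fin n
next {suc m} i = suc (toℕ i) mod (suc m)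

_==_ : ∀ {n} → Fin n → Fin n → Bool
i == j = does (i ≟ j)

adj : ∀ {n} → Fin n → Fin n → Bool
adj i j = (j == next i) ∨ (i == next j)

-- the edges of C_n are e_i = v_i v_{i+1}, i : Fin n  (distinct for n ≥ 3)
-- two edges are disjoint iff they share no endpoint
disjointᵇ : ∀ {n} → Fin n → Fin n → Bool
disjointᵇ i j = not ((i == j) ∨ (i == next j) ∨ (next i == j) ∨ (next i == next j))

allFinL : ∀ n → List (Fin n)
allFinL zero = []
allFinL (suc n) = zero ∷ map suc (allFinL n)

allᵇ : ∀ {A : Set} → (A → Bool) → List A → Bool
allᵇ p = foldr (λ a b → p a ∧ b) true

allSubsets : ∀ n → List (Subset n)
allSubsets zero = [] ∷ []
allSubsets (suc n) = map (outside ∷_) (allSubsets n) ++ map (inside ∷_) (allSubsets n)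

isMatchingᵇ : ∀ {n} → Subset n → Bool
isMatchingᵇ {n} s = allᵇ (λ i → allᵇ (λ j →
  not (lookup s i ∧ lookup s j ∧ not (i == j)) ∨ disjointᵇ i j) (allFinL n)) (allFinL n)

matchings : ∀ n → ℕ → List (Subset n)
matchings n k = filterᵇ (λ s → isMatchingᵇ s ∧ does (∣ s ∣ ℕ.≟ k)) (allSubsets n)

module _ {c ℓ : Level} (R : CommutativeRing c ℓ) where
  open CommutativeRing R hiding (zero)

  sumL : List Carrier → Carrier
  sumL = foldr _+_ 0#

  sumFin : ∀ n → (Fin n → Carrier) → Carrier
  sumFin zero    h = 0#
  sumFin (suc n) h = h zero + sumFin n (λ i → h (suc i))

  prodFin : ∀ n → (Fin n → Carrier) → Carrier
  prodFin zero    h = 1#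
  prodFin (suc n) h = h zero * prodFin n (λ i → h (suc i))

  pow : Carrier → ℕ → Carrier
  pow x zero    = 1#
  pow x (suc k) = x * pow x k

  sgn : ℕ → Carrier
  sgn k = pow (- 1#) k

  natR : ℕ → Carrier
  natR zero    = 0#
  natR (suc k) = 1# + natR k

  det : ∀ n → (Fin n → Fin n → Carrier) → Carrier
  det zero    M = 1#
  det (suc n) M = sumFin (suc n) (λ j →
    sgn (toℕ j) * (M zero j * det n (λ a b → M (suc a) (punchIn j b))))

  record IsField : Set (c ⊔ ℓ) where
    field
      0≉1     : ¬ (0# ≈ 1#)
      inverse : ∀ a → ¬ (a ≈ 0#) → Σ Carrier (λ b → a * b ≈ 1#)

  CharZero : Set ℓ
  CharZero = ∀ k → ¬ (natR (suc k) ≈ 0#)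

  -- an anti-involution of F^× , given as a map on F whose restriction to
  -- F^× = {a | a ≉ 0} is the anti-involution (values at 0 are irrelevant)
  record IsAntiInvolution (f : Carrier → Carrier) : Set (c ⊔ ℓ) where
    field
      nonzero : ∀ a → ¬ (a ≈ 0#) → ¬ (f a ≈ 0#)
      cong    : ∀ a b → ¬ (a ≈ 0#) → a ≈ b → f a ≈ f b
      invol   : ∀ a → ¬ (a ≈ 0#) → f (f a) ≈ a
      anti    : ∀ a b → ¬ (a ≈ 0#) → ¬ (b ≈ 0#) → f (a * b) ≈ f b * f a

  -- a skew gain graph on the cycle C_n : φ(v_i v_j) given for adjacent i j
  -- (values on non-adjacent pairs are irrelevant), with values in F^×
  -- and φ(v_j v_i) = f(φ(v_i v_j))
  IsSkewGainCycle : (f : Carrier → Carrier) → ∀ n → (Fin n → Fin n → Carrier) → Set ℓ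
  IsSkewGainCycle f n φ = ∀ i j → adj i j ≡ true →
    (¬ (φ i j ≈ 0#)) × (φ j i ≈ f (φ i j))

  adjMatrix : ∀ n → (Fin n → Fin n → Carrier) → Fin n → Fin n → Carrier
  adjMatrix n φ i j = if adj i j then φ i j else 0#

  Ψ : ∀ n → (Fin n → Fin n → Carrier) → Carrier → Carrier
  Ψ n φ x = det n (λ i j → (if i == j then x else 0#) - adjMatrix n φ i j)

  gmap : (Carrier → Carrier) → Carrier → Carrier
  gmap f a = a * f a

  φC : ∀ n → (Fin n → Fin n → Carrier) → Carrier
  φC n φ = prodFin n (λ i → φ i (next i))

  a2k : (Carrier → Carrier) → ∀ n → (Fin n → Fin n → Carrier) → ℕ → Carrier
  a2k f n φ k = sumL (map (λ s → prodFin n (λ i →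
      if lookup s i then gmap f (φ i (next i)) else 1#)) (matchings n k))

  cycleFormula : (Carrier → Carrier) → ∀ n → (Fin n → Fin n → Carrier) → Carrier → Carrier
  cycleFormula f n φ x =
    pow x n
    + sumL (map (λ k → sgn k * (a2k f n φ k * pow x (n ℕ.∸ (2 ℕ.* k))))
                (map suc (upTo (n / 2))))
    - (φC n φ + f (φC n φ))

-- Let N = k + 3 be the length of the cycle and g i = g(φ(v_i v_{i+1})).  Apart from its two corner
-- entries, xI − A is tridiagonal with −φ(v_i v_{i+1}) above and −φ(v_{i+1} v_i) below the diagonal,
-- and by the skew condition the product of these two entries is g i.  Expanding along the first row,
-- and the resulting minors along their first column, leaves continuants (determinants of tridiagonal
-- matrices) of paths in the g i, plus two triangular minors: the gains of C in its two directions,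
-- which are φ(C) and f(φ(C)) because an anti-involution of the abelian group F^× is a homomorphism.
-- On the other side, cutting C at the edge v_0 v_1 writes the alternating matching sum as the matching
-- polynomial of the path v_1 ⋯ v_0 minus g 0 times that of v_2 ⋯ v_{N-1}; matching polynomials of
-- paths obey the continuant recurrence, and reading that recurrence from the other end matches the
-- two sides.

module Submission where

open import Defs
open import Level using (Level)
open import Algebra.Bundles using (CommutativeRing)
open import Algebra.Solver.Ring.AlmostCommutativeRing using (_-Raw-AlmostCommutative⟶_; fromCommutativeRing)
open import Data.Nat as ℕ using (ℕ; zero; suc; _≤_; s≤s; z≤n)
import Data.Nat.Properties as ℕ
open import Data.Nat.DivMod using (_/_; _mod_; _%_; m<n⇒m%n≡m; n%n≡0; m*n/n≡m; /-monoˡ-≤)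
open import Data.Nat.Tactic.RingSolver using (solve-∀)
open import Data.Integer as ℤ using (ℤ; +_; -[1+_]; _⊖_)
import Data.Integer.Properties as ℤ
open import Data.Sign as Sign using (Sign)
open import Data.Fin as Fin using (Fin; zero; suc; toℕ; punchIn; inject₁; fromℕ)
import Data.Fin.Properties as Fin
open import Data.Fin.Subset using (∣_∣)
open import Data.Bool using (Bool; true; false; T; if_then_else_; _∧_; _∨_; not)
import Data.Bool.Properties as Bool
open import Data.Vec using (Vec; []; _∷_; lookup; replicate)
open import Data.List using (List; []; _∷_; _++_; map; filterᵇ; upTo)
import Data.List.Properties as List
open import Data.Maybe using (Maybe; just; nothing)
open import Data.Sum using (_⊎_; inj₁; inj₂; [_,_]′)
open import Data.Product using (_×_; _,_; proj₁; proj₂)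
open import Data.Empty using (⊥; ⊥-elim)
open import Function.Bundles using (mk⇔)
open import Relation.Nullary using (¬_; Dec; yes; no; does)
open import Relation.Nullary.Decidable using (dec-true; dec-false)
open import Relation.Binary.Definitions using (tri<; tri≈; tri>)
open import Relation.Binary.PropositionalEquality as ≡ using (_≡_; _≢_)

-- The standard library's ring solver normalises with coefficients from a ring mapping into the
-- carrier; ℤ maps into every commutative ring, which lets it handle signs.  The multiple _·_ is the
-- type-checking-optimised one, so ⟦ + 1 ⟧ℤ is definitionally 1#, as the solver's refl proofs need.
module IntegerCoefficients {c ℓ} (R : CommutativeRing c ℓ) where
  open CommutativeRing R hiding (zero)
  open import Relation.Binary.Reasoning.Setoid setoid
  open import Algebra.Properties.Ring ring using (-‿involutive; -0#≈0#; -1*x≈-x; -‿+-comm)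
  open import Algebra.Properties.Semiring.Mult.TCOptimised semiring using (1+×; ×-homo-+; ×1-homo-*) renaming (_×_ to _·_)

  ⟦_⟧ℤ : ℤ → Carrier
  ⟦ + n ⟧ℤ      = n · 1#
  ⟦ -[1+ n ] ⟧ℤ = - (suc n · 1#)

  ⟦_⟧± : Sign → Carrier
  ⟦ Sign.+ ⟧± = 1#
  ⟦ Sign.- ⟧± = - 1#

  ⟦⊖⟧ : ∀ m n → ⟦ m ⊖ n ⟧ℤ ≈ m · 1# - n · 1#
  ⟦⊖⟧ zero    zero    = sym (-‿inverseʳ 0#)
  ⟦⊖⟧ zero    (suc n) = begin
    ⟦ 0 ⊖ suc n ⟧ℤ      ≡⟨ ≡.cong ⟦_⟧ℤ (ℤ.⊖-swap 0 (suc n)) ⟩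
    - (suc n · 1#)      ≈⟨ +-identityˡ _ ⟨
    0# - (suc n · 1#)   ∎
  ⟦⊖⟧ (suc m) zero    = sym (trans (+-congˡ -0#≈0#) (+-identityʳ _))
  ⟦⊖⟧ (suc m) (suc n) = begin
    ⟦ suc m ⊖ suc n ⟧ℤ            ≡⟨ ≡.cong ⟦_⟧ℤ (ℤ.[1+m]⊖[1+n]≡m⊖n m n) ⟩
    ⟦ m ⊖ n ⟧ℤ                    ≈⟨ ⟦⊖⟧ m n ⟩
    a - b                         ≈⟨ +-identityˡ _ ⟨
    0# + (a - b)                  ≈⟨ +-congʳ (-‿inverseʳ 1#) ⟨
    (1# - 1#) + (a - b)           ≈⟨ +-assoc 1# (- 1#) (a - b) ⟩
    1# + (- 1# + (a - b))         ≈⟨ +-congˡ (+-assoc (- 1#) a (- b)) ⟨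
    1# + ((- 1# + a) - b)         ≈⟨ +-congˡ (+-congʳ (+-comm (- 1#) a)) ⟩
    1# + ((a - 1#) - b)           ≈⟨ +-congˡ (+-assoc a (- 1#) (- b)) ⟩
    1# + (a + (- 1# - b))         ≈⟨ +-assoc 1# a _ ⟨
    (1# + a) + (- 1# - b)         ≈⟨ +-congˡ (-‿+-comm 1# b) ⟩
    (1# + a) - (1# + b)           ≈⟨ +-cong (1+× m 1#) (-‿cong (1+× n 1#)) ⟨
    suc m · 1# - suc n · 1#       ∎
    where a = m · 1#; b = n · 1#

  ⟦-⟧-homo : ∀ i → ⟦ ℤ.- i ⟧ℤ ≈ - ⟦ i ⟧ℤ
  ⟦-⟧-homo (+ zero)  = sym -0#≈0#
  ⟦-⟧-homo (+ suc n) = refl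
  ⟦-⟧-homo -[1+ n ]  = sym (-‿involutive _)

  ⟦+⟧-homo : ∀ i j → ⟦ i ℤ.+ j ⟧ℤ ≈ ⟦ i ⟧ℤ + ⟦ j ⟧ℤ
  ⟦+⟧-homo -[1+ m ] -[1+ n ] = begin
    - (suc (suc (m ℕ.+ n)) · 1#)        ≡⟨ ≡.cong (λ k → - (k · 1#)) (ℕ.+-suc (suc m) n) ⟨
    - ((suc m ℕ.+ suc n) · 1#)          ≈⟨ -‿cong (×-homo-+ 1# (suc m) (suc n)) ⟩
    - (suc m · 1# + suc n · 1#)         ≈⟨ -‿+-comm _ _ ⟨
    - (suc m · 1#) + - (suc n · 1#)     ∎
  ⟦+⟧-homo -[1+ m ] (+ n)    = trans (⟦⊖⟧ n (suc m)) (+-comm _ _)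
  ⟦+⟧-homo (+ m)    -[1+ n ] = ⟦⊖⟧ m (suc n)
  ⟦+⟧-homo (+ m)    (+ n)    = ×-homo-+ 1# m n

  ⟦◃⟧ : ∀ s n → ⟦ s ℤ.◃ n ⟧ℤ ≈ ⟦ s ⟧± * n · 1#
  ⟦◃⟧ s        zero    = sym (zeroʳ _)
  ⟦◃⟧ Sign.-   (suc n) = sym (-1*x≈-x _)
  ⟦◃⟧ Sign.+   (suc n) = sym (*-identityˡ _)

  ⟦·⟧-homo : ∀ s t → ⟦ s Sign.* t ⟧± ≈ ⟦ s ⟧± * ⟦ t ⟧±
  ⟦·⟧-homo Sign.- Sign.- = sym (trans (-1*x≈-x (- 1#)) (-‿involutive _))
  ⟦·⟧-homo Sign.- Sign.+ = sym (*-identityʳ _)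
  ⟦·⟧-homo Sign.+ t      = sym (*-identityˡ _)

  ⟦*⟧-homo : ∀ i j → ⟦ i ℤ.* j ⟧ℤ ≈ ⟦ i ⟧ℤ * ⟦ j ⟧ℤ
  ⟦*⟧-homo i j = begin
    ⟦ i ℤ.* j ⟧ℤ                              ≈⟨ ⟦◃⟧ (ℤ.sign i Sign.* ℤ.sign j) (ℤ.∣ i ∣ ℕ.* ℤ.∣ j ∣) ⟩
    ⟦ ℤ.sign i Sign.* ℤ.sign j ⟧± * (ℤ.∣ i ∣ ℕ.* ℤ.∣ j ∣) · 1#
                                              ≈⟨ *-cong (⟦·⟧-homo (ℤ.sign i) (ℤ.sign j)) (×1-homo-* ℤ.∣ i ∣ ℤ.∣ j ∣) ⟩
    (si * sj) * (ni * nj)                     ≈⟨ *-assoc si sj _ ⟩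
    si * (sj * (ni * nj))                     ≈⟨ *-congˡ (*-assoc sj ni nj) ⟨
    si * ((sj * ni) * nj)                     ≈⟨ *-congˡ (*-congʳ (*-comm sj ni)) ⟩
    si * ((ni * sj) * nj)                     ≈⟨ *-congˡ (*-assoc ni sj nj) ⟩
    si * (ni * (sj * nj))                     ≈⟨ *-assoc si ni _ ⟨
    (si * ni) * (sj * nj)                     ≈⟨ *-cong (⟦◃⟧ (ℤ.sign i) ℤ.∣ i ∣) (⟦◃⟧ (ℤ.sign j) ℤ.∣ j ∣) ⟨
    ⟦ ℤ.sign i ℤ.◃ ℤ.∣ i ∣ ⟧ℤ * ⟦ ℤ.sign j ℤ.◃ ℤ.∣ j ∣ ⟧ℤ
                                              ≡⟨ ≡.cong₂ (λ a b → ⟦ a ⟧ℤ * ⟦ b ⟧ℤ) (ℤ.◃-inverse i) (ℤ.◃-inverse j) ⟩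
    ⟦ i ⟧ℤ * ⟦ j ⟧ℤ                           ∎
    where
    si = ⟦ ℤ.sign i ⟧±
    sj = ⟦ ℤ.sign j ⟧±
    ni = ℤ.∣ i ∣ · 1#
    nj = ℤ.∣ j ∣ · 1#

  ⟦⟧-homomorphism : ℤ.+-*-rawRing -Raw-AlmostCommutative⟶ fromCommutativeRing R
  ⟦⟧-homomorphism = record
    { ⟦_⟧    = ⟦_⟧ℤ
    ; +-homo = ⟦+⟧-homo
    ; *-homo = ⟦*⟧-homo
    ; -‿homo = ⟦-⟧-homo
    ; 0-homo = refl
    ; 1-homo = refl
    }

  ⟦⟧-≟ : ∀ i j → Maybe (⟦ i ⟧ℤ ≈ ⟦ j ⟧ℤ)
  ⟦⟧-≟ i j with i ℤ.≟ j
  ... | yes ≡.refl = just refl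
  ... | no _       = nothing

  open import Algebra.Solver.Ring ℤ.+-*-rawRing (fromCommutativeRing R) ⟦⟧-homomorphism ⟦⟧-≟ public

module FiniteSums {c ℓ} (R : CommutativeRing c ℓ) where
  open CommutativeRing R hiding (zero)
  open import Relation.Binary.Reasoning.Setoid setoid
  open IntegerCoefficients R using (solve; _:=_; _:+_; _:*_; :-_; con)

  sumFin-cong : ∀ n {g h : Fin n → Carrier} → (∀ i → g i ≈ h i) → sumFin R n g ≈ sumFin R n h
  sumFin-cong zero    _   = refl
  sumFin-cong (suc n) g≈h = +-cong (g≈h zero) (sumFin-cong n (λ i → g≈h (suc i)))

  prodFin-cong : ∀ n {g h : Fin n → Carrier} → (∀ i → g i ≈ h i) → prodFin R n g ≈ prodFin R n h
  prodFin-cong zero    _   = refl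
  prodFin-cong (suc n) g≈h = *-cong (g≈h zero) (prodFin-cong n (λ i → g≈h (suc i)))

  sumFin-0 : ∀ n {h : Fin n → Carrier} → (∀ i → h i ≈ 0#) → sumFin R n h ≈ 0#
  sumFin-0 zero    _   = refl
  sumFin-0 (suc n) h≈0 = trans (+-cong (h≈0 zero) (sumFin-0 n (λ i → h≈0 (suc i)))) (+-identityʳ 0#)

  sumFin-+ : ∀ n (g h : Fin n → Carrier) → sumFin R n (λ i → g i + h i) ≈ sumFin R n g + sumFin R n h
  sumFin-+ zero    g h = sym (+-identityʳ 0#)
  sumFin-+ (suc n) g h = trans (+-congˡ (sumFin-+ n _ _))
    (solve 4 (λ a b s t → (a :+ b) :+ (s :+ t) := (a :+ s) :+ (b :+ t)) refl _ _ _ _)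

  sumFin-*ˡ : ∀ n a (h : Fin n → Carrier) → a * sumFin R n h ≈ sumFin R n (λ i → a * h i)
  sumFin-*ˡ zero    a h = zeroʳ a
  sumFin-*ˡ (suc n) a h = trans (distribˡ _ _ _) (+-congˡ (sumFin-*ˡ n a _))

  sumFin-swap : ∀ n m (h : Fin n → Fin m → Carrier) →
    sumFin R n (λ i → sumFin R m (h i)) ≈ sumFin R m (λ j → sumFin R n (λ i → h i j))
  sumFin-swap zero    m h = sym (sumFin-0 m (λ _ → refl))
  sumFin-swap (suc n) m h = trans (+-congˡ (sumFin-swap n m _)) (sym (sumFin-+ m _ _))

  sumFin-head : ∀ n (h : Fin (suc n) → Carrier) → (∀ i → h (suc i) ≈ 0#) → sumFin R (suc n) h ≈ h zero
  sumFin-head n h tail≈0 = trans (+-congˡ (sumFin-0 n tail≈0)) (+-identityʳ _)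

  sumFin-last : ∀ n (h : Fin (suc n) → Carrier) →
    sumFin R (suc n) h ≈ sumFin R n (λ i → h (inject₁ i)) + h (fromℕ n)
  sumFin-last zero    h = trans (+-identityʳ _) (sym (+-identityˡ _))
  sumFin-last (suc n) h = trans (+-congˡ (sumFin-last n (λ i → h (suc i)))) (sym (+-assoc _ _ _))

  prodFin-last : ∀ n (h : Fin (suc n) → Carrier) →
    prodFin R (suc n) h ≈ prodFin R n (λ i → h (inject₁ i)) * h (fromℕ n)
  prodFin-last zero    h = trans (*-identityʳ _) (sym (*-identityˡ _))
  prodFin-last (suc n) h = trans (*-congˡ (prodFin-last n (λ i → h (suc i)))) (sym (*-assoc _ _ _))

  sgn-square : ∀ n → sgn R n * sgn R n ≈ 1#
  sgn-square zero    = *-identityˡ 1#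
  sgn-square (suc n) = trans (solve 1 (λ s → (:- con (+ 1) :* s) :* (:- con (+ 1) :* s) := s :* s) refl (sgn R n))
                             (sgn-square n)

  prodFin-neg : ∀ n (h : Fin n → Carrier) → prodFin R n (λ i → - h i) ≈ sgn R n * prodFin R n h
  prodFin-neg zero    h = sym (*-identityˡ 1#)
  prodFin-neg (suc n) h = trans (*-congˡ (prodFin-neg n (λ i → h (suc i))))
    (solve 3 (λ a s p → (:- a) :* (s :* p) := (:- con (+ 1) :* s) :* (a :* p)) refl (h zero) (sgn R n) _)

  sumL-++ : ∀ (xs ys : List Carrier) → sumL R (xs ++ ys) ≈ sumL R xs + sumL R ys
  sumL-++ []       ys = sym (+-identityˡ _)
  sumL-++ (a ∷ xs) ys = trans (+-congˡ (sumL-++ xs ys)) (sym (+-assoc _ _ _))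

  sumL-cong : ∀ {A : Set} (as : List A) {g h : A → Carrier} → (∀ a → g a ≈ h a) →
    sumL R (map g as) ≈ sumL R (map h as)
  sumL-cong []       _   = refl
  sumL-cong (a ∷ as) g≈h = +-cong (g≈h a) (sumL-cong as g≈h)

  sumL-0 : ∀ {A : Set} (as : List A) {h : A → Carrier} → (∀ a → h a ≈ 0#) → sumL R (map h as) ≈ 0#
  sumL-0 []       _   = refl
  sumL-0 (a ∷ as) h≈0 = trans (+-cong (h≈0 a) (sumL-0 as h≈0)) (+-identityʳ 0#)

  sumL-filterᵇ : ∀ {A : Set} (p : A → Bool) (h : A → Carrier) (as : List A) →
    sumL R (map h (filterᵇ p as)) ≈ sumL R (map (λ a → if p a then h a else 0#) as)
  sumL-filterᵇ p h []       = refl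
  sumL-filterᵇ p h (a ∷ as) with p a
  ... | true  = +-congˡ (sumL-filterᵇ p h as)
  ... | false = trans (sumL-filterᵇ p h as) (sym (+-identityˡ _))

  sumL-snoc : ∀ {A : Set} (as : List A) (h : A → Carrier) a →
    sumL R (map h (as ++ a ∷ [])) ≈ sumL R (map h as) + h a
  sumL-snoc as h a = trans (reflexive (≡.cong (sumL R) (List.map-++ h as (a ∷ []))))
                           (trans (sumL-++ (map h as) (h a ∷ [])) (+-congˡ (+-identityʳ _)))

  sumSubset : ∀ n → (Vec Bool n → Carrier) → Carrier
  sumSubset zero    h = h []
  sumSubset (suc n) h = sumSubset n (λ t → h (false ∷ t)) + sumSubset n (λ t → h (true ∷ t))

  sumSubset-cong : ∀ n {g h : Vec Bool n → Carrier} → (∀ s → g s ≈ h s) → sumSubset n g ≈ sumSubset n h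
  sumSubset-cong zero    g≈h = g≈h []
  sumSubset-cong (suc n) g≈h = +-cong (sumSubset-cong n (λ t → g≈h (false ∷ t)))
                                      (sumSubset-cong n (λ t → g≈h (true ∷ t)))

  sumSubset-0 : ∀ n {h : Vec Bool n → Carrier} → (∀ s → h s ≈ 0#) → sumSubset n h ≈ 0#
  sumSubset-0 zero    h≈0 = h≈0 []
  sumSubset-0 (suc n) h≈0 = trans (+-cong (sumSubset-0 n (λ t → h≈0 (false ∷ t)))
                                          (sumSubset-0 n (λ t → h≈0 (true ∷ t))))
                                  (+-identityʳ 0#)

  sumSubset-+ : ∀ n (g h : Vec Bool n → Carrier) →
    sumSubset n (λ s → g s + h s) ≈ sumSubset n g + sumSubset n h
  sumSubset-+ zero    g h = refl
  sumSubset-+ (suc n) g h = trans (+-cong (sumSubset-+ n _ _) (sumSubset-+ n _ _))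
    (solve 4 (λ a b d e → (a :+ b) :+ (d :+ e) := (a :+ d) :+ (b :+ e)) refl _ _ _ _)

  sumSubset-*ˡ : ∀ n a (h : Vec Bool n → Carrier) → a * sumSubset n h ≈ sumSubset n (λ s → a * h s)
  sumSubset-*ˡ zero    a h = refl
  sumSubset-*ˡ (suc n) a h = trans (distribˡ a _ _) (+-cong (sumSubset-*ˡ n a _) (sumSubset-*ˡ n a _))

  sumSubset-*ʳ : ∀ n a (h : Vec Bool n → Carrier) → sumSubset n h * a ≈ sumSubset n (λ s → h s * a)
  sumSubset-*ʳ n a h = trans (*-comm _ _) (trans (sumSubset-*ˡ n a h) (sumSubset-cong n (λ s → *-comm a (h s))))

  sumSubset-empty : ∀ n (h : Vec Bool n → Carrier) →
    sumSubset n (λ s → if does (∣ s ∣ ℕ.≟ 0) then h s else 0#) ≈ h (replicate n false)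
  sumSubset-empty zero    h = refl
  sumSubset-empty (suc n) h = trans (+-cong (sumSubset-empty n (λ t → h (false ∷ t))) (sumSubset-0 n (λ _ → refl)))
                                    (+-identityʳ _)

  sumL-allSubsets : ∀ n (h : Vec Bool n → Carrier) → sumL R (map h (allSubsets n)) ≈ sumSubset n h
  sumL-allSubsets zero    h = +-identityʳ _
  sumL-allSubsets (suc n) h = begin
    sumL R (map h (map (false ∷_) S ++ map (true ∷_) S))
      ≡⟨ ≡.cong (sumL R) (List.map-++ h (map (false ∷_) S) (map (true ∷_) S)) ⟩
    sumL R (map h (map (false ∷_) S) ++ map h (map (true ∷_) S))
      ≈⟨ sumL-++ (map h (map (false ∷_) S)) (map h (map (true ∷_) S)) ⟩
    sumL R (map h (map (false ∷_) S)) + sumL R (map h (map (true ∷_) S))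
      ≡⟨ ≡.cong₂ (λ xs ys → sumL R xs + sumL R ys) (List.map-∘ S) (List.map-∘ S) ⟨
    sumL R (map (λ t → h (false ∷ t)) S) + sumL R (map (λ t → h (true ∷ t)) S)
      ≈⟨ +-cong (sumL-allSubsets n _) (sumL-allSubsets n _) ⟩
    sumSubset (suc n) h ∎
    where S = allSubsets n

  sumL-sumSubset : ∀ {A : Set} n (as : List A) (h : A → Vec Bool n → Carrier) →
    sumL R (map (λ a → sumSubset n (h a)) as) ≈ sumSubset n (λ s → sumL R (map (λ a → h a s) as))
  sumL-sumSubset n []       h = sym (sumSubset-0 n (λ _ → refl))
  sumL-sumSubset n (a ∷ as) h = trans (+-congˡ (sumL-sumSubset n as h)) (sym (sumSubset-+ n _ _))

  select : ℕ → (ℕ → Carrier) → ℕ → Carrier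
  select v h j = if does (v ℕ.≟ j) then h j else 0#

  select-≢ : ∀ v h j → ¬ v ≡ j → select v h j ≈ 0#
  select-≢ v h j v≢j with v ℕ.≡ᵇ j in eq
  ... | false = refl
  ... | true  = ⊥-elim (v≢j (ℕ.≡ᵇ⇒≡ v j (≡.subst T (≡.sym eq) _)))

  select-≡ : ∀ v h → select v h v ≈ h v
  select-≡ v h with v ℕ.≡ᵇ v in eq
  ... | true  = refl
  ... | false = ⊥-elim (≡.subst T eq (ℕ.≡⇒≡ᵇ v v ≡.refl))

  sumL-select-snoc : ∀ q v h → sumL R (map (select v h) (map suc (upTo (suc q))))
    ≈ sumL R (map (select v h) (map suc (upTo q))) + select v h (suc q)
  sumL-select-snoc q v h = begin
    sumL R (map (select v h) (map suc (upTo (suc q))))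
      ≡⟨ ≡.cong (λ js → sumL R (map (select v h) (map suc js))) (List.upTo-∷ʳ q) ⟨
    sumL R (map (select v h) (map suc (upTo q ++ q ∷ [])))
      ≡⟨ ≡.cong (λ js → sumL R (map (select v h) js)) (List.map-++ suc (upTo q) (q ∷ [])) ⟩
    sumL R (map (select v h) (map suc (upTo q) ++ suc q ∷ []))
      ≈⟨ sumL-snoc (map suc (upTo q)) (select v h) (suc q) ⟩
    sumL R (map (select v h) (map suc (upTo q))) + select v h (suc q) ∎

  sumL-select-∉ : ∀ q v h → v ≡ 0 ⊎ q ℕ.< v → sumL R (map (select v h) (map suc (upTo q))) ≈ 0#
  sumL-select-∉ zero    v h _  = refl
  sumL-select-∉ (suc q) v h v∉ = trans (sumL-select-snoc q v h)
    (trans (+-cong (sumL-select-∉ q v h ([ inj₁ , (λ q<v → inj₂ (ℕ.<-trans (ℕ.n<1+n q) q<v)) ]′ v∉))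
                   (select-≢ v h (suc q) ([ (λ { ≡.refl () }) , (λ q<v v≡ → ℕ.<-irrefl (≡.sym v≡) q<v) ]′ v∉)))
           (+-identityʳ 0#))

  sumL-select-∈ : ∀ q v h → 1 ℕ.≤ v → v ℕ.≤ q → sumL R (map (select v h) (map suc (upTo q))) ≈ h v
  sumL-select-∈ zero    v h 1≤v v≤0 = ⊥-elim (ℕ.<-irrefl ≡.refl (ℕ.≤-trans 1≤v v≤0))
  sumL-select-∈ (suc q) v h 1≤v v≤q with v ℕ.≟ suc q
  ... | yes ≡.refl = trans (sumL-select-snoc q v h)
    (trans (+-cong (sumL-select-∉ q v h (inj₂ (ℕ.n<1+n q))) (select-≡ v h)) (+-identityˡ _))
  ... | no v≢1+q = trans (sumL-select-snoc q v h)
    (trans (+-cong (sumL-select-∈ q v h 1≤v (ℕ.≤-pred (ℕ.≤∧≢⇒< v≤q v≢1+q))) (select-≢ v h (suc q) v≢1+q))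
           (+-identityʳ _))

  select-decomposition : ∀ q v h → v ℕ.≤ q → select v h 0 + sumL R (map (select v h) (map suc (upTo q))) ≈ h v
  select-decomposition q zero    h _   = trans (+-congˡ (sumL-select-∉ q 0 h (inj₁ ≡.refl))) (+-identityʳ _)
  select-decomposition q (suc v) h v≤q =
    trans (+-cong (select-≢ (suc v) h 0 (λ ())) (sumL-select-∈ q (suc v) h (ℕ.s≤s ℕ.z≤n) v≤q)) (+-identityˡ _)

module Determinant {c ℓ} (R : CommutativeRing c ℓ) where
  open CommutativeRing R hiding (zero)
  open import Relation.Binary.Reasoning.Setoid setoid
  open IntegerCoefficients R using (solve; _:=_; _:+_; _:*_; :-_; _:-_; con)
  open FiniteSums R

  Matrix : ℕ → Set c
  Matrix n = Fin n → Fin n → Carrier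

  det-cong : ∀ n {M N : Matrix n} → (∀ a b → M a b ≈ N a b) → det R n M ≈ det R n N
  det-cong zero    _   = refl
  det-cong (suc n) {M} {N} M≈N = sumFin-cong (suc n) (λ j → *-congˡ {x = sgn R (toℕ j)} (*-cong (M≈N zero j)
    (det-cong n {λ a b → M (suc a) (punchIn j b)} {λ a b → N (suc a) (punchIn j b)}
                (λ a b → M≈N (suc a) (punchIn j b)))))

  rowTerm : ∀ n → Matrix (suc n) → Fin (suc n) → Carrier
  rowTerm n M j = sgn R (toℕ j) * (M zero j * det R n (λ a b → M (suc a) (punchIn j b)))

  columnTerm : ∀ n → Matrix (suc n) → Fin (suc n) → Carrier
  columnTerm n M i = sgn R (toℕ i) * (M i zero * det R n (λ a b → M (punchIn i a) (suc b)))

  -- Expanding both sides once more, the two double sums differ only in the order of summation.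
  det-columnExpansion : ∀ n (M : Matrix (suc n)) → det R (suc n) M ≈ sumFin R (suc n) (columnTerm n M)
  det-columnExpansion zero    M = refl
  det-columnExpansion (suc n) M = +-congˡ (trans
    (sumFin-cong (suc n) (λ j → *-congˡ {x = sgn R (suc (toℕ j))} (*-congˡ {x = M zero (suc j)} (det-columnExpansion n (λ a b → M (suc a) (punchIn (suc j) b))))))
    (interchange (λ j → M zero (suc j)) (λ i → M (suc i) zero)
                 (λ i j → det R n (λ a b → M (suc (punchIn i a)) (suc (punchIn j b))))))
    where
    interchange : ∀ (A B : Fin (suc n) → Carrier) (D : Matrix (suc n)) →
      sumFin R (suc n) (λ j → sgn R (suc (toℕ j)) * (A j * sumFin R (suc n) (λ i → sgn R (toℕ i) * (B i * D i j))))
      ≈ sumFin R (suc n) (λ i → sgn R (suc (toℕ i)) * (B i * sumFin R (suc n) (λ j → sgn R (toℕ j) * (A j * D i j))))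
    interchange A B D = begin
      Σ (λ j → sgn R (suc (toℕ j)) * (A j * Σ (λ i → sgn R (toℕ i) * (B i * D i j))))
        ≈⟨ sumFin-cong (suc n) (λ j → pull (sgn R (suc (toℕ j))) (A j) (λ i → sgn R (toℕ i) * (B i * D i j))) ⟩
      Σ (λ j → Σ (λ i → sgn R (suc (toℕ j)) * (A j * (sgn R (toℕ i) * (B i * D i j)))))
        ≈⟨ sumFin-swap (suc n) (suc n) (λ j i → sgn R (suc (toℕ j)) * (A j * (sgn R (toℕ i) * (B i * D i j)))) ⟩
      Σ (λ i → Σ (λ j → sgn R (suc (toℕ j)) * (A j * (sgn R (toℕ i) * (B i * D i j)))))
        ≈⟨ sumFin-cong (suc n) (λ i → sumFin-cong (suc n) (λ j →
             solve 5 (λ sj a si b d → (:- con (+ 1) :* sj) :* (a :* (si :* (b :* d)))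
                                   := (:- con (+ 1) :* si) :* (b :* (sj :* (a :* d))))
                     refl (sgn R (toℕ j)) (A j) (sgn R (toℕ i)) (B i) (D i j))) ⟩
      Σ (λ i → Σ (λ j → sgn R (suc (toℕ i)) * (B i * (sgn R (toℕ j) * (A j * D i j)))))
        ≈⟨ sumFin-cong (suc n) (λ i → pull (sgn R (suc (toℕ i))) (B i) (λ j → sgn R (toℕ j) * (A j * D i j))) ⟨
      Σ (λ i → sgn R (suc (toℕ i)) * (B i * Σ (λ j → sgn R (toℕ j) * (A j * D i j)))) ∎
      where
      Σ = sumFin R (suc n)
      pull : ∀ s a h → s * (a * Σ h) ≈ Σ (λ i → s * (a * h i))
      pull s a h = trans (*-congˡ (sumFin-*ˡ (suc n) a h)) (sumFin-*ˡ (suc n) s (λ i → a * h i))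

  private
    vanishingTerm : ∀ s d → s * (0# * d) ≈ 0#
    vanishingTerm s d = trans (*-congˡ (zeroˡ d)) (zeroʳ s)

  det-lowerTriangular : ∀ n (M : Matrix n) → (∀ i j → toℕ i ℕ.< toℕ j → M i j ≈ 0#) →
    det R n M ≈ prodFin R n (λ i → M i i)
  det-lowerTriangular zero    M _     = refl
  det-lowerTriangular (suc n) M upper≈0 = begin
    det R (suc n) M
      ≈⟨ sumFin-head n (rowTerm n M) (λ j → trans (*-congˡ (*-congʳ (upper≈0 zero (suc j) (ℕ.s≤s ℕ.z≤n)))) (vanishingTerm _ _)) ⟩
    1# * (M zero zero * det R n (λ a b → M (suc a) (suc b)))
      ≈⟨ *-identityˡ _ ⟩
    M zero zero * det R n (λ a b → M (suc a) (suc b))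
      ≈⟨ *-congˡ (det-lowerTriangular n _ (λ i j i<j → upper≈0 (suc i) (suc j) (ℕ.s≤s i<j))) ⟩
    prodFin R (suc n) (λ i → M i i) ∎

  det-upperTriangular : ∀ n (M : Matrix n) → (∀ i j → toℕ j ℕ.< toℕ i → M i j ≈ 0#) →
    det R n M ≈ prodFin R n (λ i → M i i)
  det-upperTriangular zero    M _     = refl
  det-upperTriangular (suc n) M lower≈0 = begin
    det R (suc n) M
      ≈⟨ det-columnExpansion n M ⟩
    sumFin R (suc n) (columnTerm n M)
      ≈⟨ sumFin-head n (columnTerm n M) (λ i → trans (*-congˡ (*-congʳ (lower≈0 (suc i) zero (ℕ.s≤s ℕ.z≤n)))) (vanishingTerm _ _)) ⟩
    1# * (M zero zero * det R n (λ a b → M (suc a) (suc b)))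
      ≈⟨ *-identityˡ _ ⟩
    M zero zero * det R n (λ a b → M (suc a) (suc b))
      ≈⟨ *-congˡ (det-upperTriangular n _ (λ i j j<i → lower≈0 (suc i) (suc j) (ℕ.s≤s j<i))) ⟩
    prodFin R (suc n) (λ i → M i i) ∎

  onlyAt0 : Carrier → ℕ → Carrier
  onlyAt0 a zero    = a
  onlyAt0 a (suc _) = 0#

  -- Diagonal x, u i at (i, i+1) and l i at (i+1, i); indexing by ℕ makes the trailing minors
  -- tridiagonal matrices of the same shape.
  tridiagonal : Carrier → (ℕ → Carrier) → (ℕ → Carrier) → ℕ → ℕ → Carrier
  tridiagonal x u l zero    zero    = x
  tridiagonal x u l zero    (suc j) = onlyAt0 (u 0) j
  tridiagonal x u l (suc i) zero    = onlyAt0 (l 0) i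
  tridiagonal x u l (suc i) (suc j) = tridiagonal x (λ t → u (suc t)) (λ t → l (suc t)) i j

  continuant : Carrier → (ℕ → Carrier) → ℕ → Carrier
  continuant x g zero          = 1#
  continuant x g (suc zero)    = x
  continuant x g (suc (suc m)) =
    x * continuant x (λ t → g (suc t)) (suc m) - g 0 * continuant x (λ t → g (suc (suc t))) m

  continuant-cong : ∀ x m {g h : ℕ → Carrier} → (∀ i → g i ≈ h i) → continuant x g m ≈ continuant x h m
  continuant-cong x zero          g≈h = refl
  continuant-cong x (suc zero)    g≈h = refl
  continuant-cong x (suc (suc m)) g≈h =
    +-cong (*-congˡ (continuant-cong x (suc m) (λ i → g≈h (suc i))))
           (-‿cong (*-cong (g≈h 0) (continuant-cong x m (λ i → g≈h (suc (suc i))))))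

  continuant-recurrenceʳ : ∀ x m g →
    continuant x g (suc (suc m)) ≈ x * continuant x g (suc m) - g m * continuant x g m
  continuant-recurrenceʳ x zero          g = refl
  continuant-recurrenceʳ x (suc zero)    g =
    solve 3 (λ x a b → x :* (x :* x :- b :* con (+ 1)) :- a :* x := x :* (x :* x :- a :* con (+ 1)) :- b :* x)
          refl x (g 0) (g 1)
  continuant-recurrenceʳ x (suc (suc m)) g = begin
    x * continuant x g′ (suc (suc (suc m))) - g 0 * continuant x g″ (suc (suc m))
      ≈⟨ +-cong (*-congˡ (continuant-recurrenceʳ x (suc m) g′)) (-‿cong (*-congˡ (continuant-recurrenceʳ x m g″))) ⟩
    x * (x * A - gₘ * B) - g 0 * (x * C - gₘ * D)
      ≈⟨ solve 7 (λ x A B C D a b → x :* (x :* A :- b :* B) :- a :* (x :* C :- b :* D)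
                                 := x :* (x :* A :- a :* C) :- b :* (x :* B :- a :* D)) refl x A B C D (g 0) gₘ ⟩
    x * (x * A - g 0 * C) - gₘ * (x * B - g 0 * D) ∎
    where
    g′ = λ i → g (suc i)
    g″ = λ i → g (suc (suc i))
    gₘ = g (suc (suc m))
    A = continuant x g′ (suc (suc m))
    B = continuant x g′ (suc m)
    C = continuant x g″ (suc m)
    D = continuant x g″ m

  det-tridiagonal : ∀ m x u l →
    det R m (λ a b → tridiagonal x u l (toℕ a) (toℕ b)) ≈ continuant x (λ i → u i * l i) m
  det-tridiagonal zero          x u l = refl
  det-tridiagonal (suc zero)    x u l = trans (+-identityʳ _) (trans (*-identityˡ _) (*-identityʳ x))
  det-tridiagonal (suc (suc m)) x u l = begin
    _ ≈⟨ +-cong (*-congˡ {x = 1#} (*-congˡ {x = x} (det-tridiagonal (suc m) x u′ l′)))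
                (+-cong (*-congˡ {x = sgn R 1} (*-congˡ {x = u 0} minor))
                        (sumFin-0 m (λ j → vanishingTerm _ _))) ⟩
    1# * (x * P₁) + (sgn R 1 * (u 0 * (1# * (l 0 * P₂))) + 0#)
      ≈⟨ solve 5 (λ x P₁ u₀ l₀ P₂ → con (+ 1) :* (x :* P₁) :+ ((:- con (+ 1) :* con (+ 1)) :* (u₀ :* (con (+ 1) :* (l₀ :* P₂))) :+ con (+ 0))
                                 := x :* P₁ :- u₀ :* l₀ :* P₂) refl x P₁ (u 0) (l 0) P₂ ⟩
    x * P₁ - u 0 * l 0 * P₂ ∎
    where
    u′ l′ : ℕ → Carrier
    u′ i = u (suc i)
    l′ i = l (suc i)
    P₁ = continuant x (λ i → u′ i * l′ i) (suc m)
    P₂ = continuant x (λ i → u (suc (suc i)) * l (suc (suc i))) m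
    M₁ : Matrix (suc m)
    M₁ a b = tridiagonal x u l (suc (toℕ a)) (toℕ (punchIn (suc zero) b))
    minor : det R (suc m) M₁ ≈ 1# * (l 0 * P₂)
    minor = trans (det-columnExpansion m M₁) (trans (sumFin-head m (columnTerm m M₁) (λ j → vanishingTerm _ _))
              (*-congˡ {x = 1#} (*-congˡ {x = l 0} (det-tridiagonal m x (λ i → u (suc (suc i))) (λ i → l (suc (suc i)))))))

  tridiagonal-diagonal : ∀ x u l i → tridiagonal x u l i i ≡ x
  tridiagonal-diagonal x u l zero    = ≡.refl
  tridiagonal-diagonal x u l (suc i) = tridiagonal-diagonal x _ _ i

  tridiagonal-above : ∀ x u l i → tridiagonal x u l i (suc i) ≡ u i
  tridiagonal-above x u l zero    = ≡.refl
  tridiagonal-above x u l (suc i) = tridiagonal-above x (λ t → u (suc t)) (λ t → l (suc t)) i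

  tridiagonal-below : ∀ x u l i → tridiagonal x u l (suc i) i ≡ l i
  tridiagonal-below x u l zero    = ≡.refl
  tridiagonal-below x u l (suc i) = tridiagonal-below x (λ t → u (suc t)) (λ t → l (suc t)) i

  tridiagonal-farAbove : ∀ x u l i j → suc i ℕ.< j → tridiagonal x u l i j ≡ 0#
  tridiagonal-farAbove x u l zero    (suc (suc j)) _           = ≡.refl
  tridiagonal-farAbove x u l zero    (suc zero)    (ℕ.s≤s ())
  tridiagonal-farAbove x u l (suc i) (suc j)       (ℕ.s≤s i<j) = tridiagonal-farAbove x _ _ i j i<j

  tridiagonal-farBelow : ∀ x u l i j → suc j ℕ.< i → tridiagonal x u l i j ≡ 0#
  tridiagonal-farBelow x u l (suc (suc i)) zero    _           = ≡.refl
  tridiagonal-farBelow x u l (suc zero)    zero    (ℕ.s≤s ())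
  tridiagonal-farBelow x u l (suc i)       (suc j) (ℕ.s≤s j<i) = tridiagonal-farBelow x _ _ i j j<i

  -- The tridiagonal matrix of size k + 3 with the corner entries α at (0, k+2) and β at (k+2, 0).
  cyclic : ℕ → Carrier → (ℕ → Carrier) → (ℕ → Carrier) → Carrier → Carrier → ℕ → ℕ → Carrier
  cyclic k x u l α β zero    j       = tridiagonal x u l zero j + select (suc (suc k)) (λ _ → α) j
  cyclic k x u l α β (suc i) zero    = tridiagonal x u l (suc i) zero + select (suc k) (λ _ → β) i
  cyclic k x u l α β (suc i) (suc j) = tridiagonal x u l (suc i) (suc j)

  module _ (k : ℕ) (x : Carrier) (u l : ℕ → Carrier) (α β : Carrier) where
    private
      C : ℕ → ℕ → Carrier
      C = cyclic k x u l α β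
      K : ℕ
      K = suc (suc k)

    cyclic-diagonal : ∀ i → C i i ≈ x
    cyclic-diagonal zero    = +-identityʳ x
    cyclic-diagonal (suc i) = reflexive (tridiagonal-diagonal x _ _ i)

    cyclic-above : ∀ i → C i (suc i) ≈ u i
    cyclic-above zero    = +-identityʳ (u 0)
    cyclic-above (suc i) = reflexive (tridiagonal-above x _ _ i)

    cyclic-below : ∀ i → C (suc i) i ≈ l i
    cyclic-below zero    = +-identityʳ (l 0)
    cyclic-below (suc i) = reflexive (tridiagonal-below x _ _ i)

    cyclic-topRight : C zero K ≈ α
    cyclic-topRight = trans (+-congˡ (select-≡ K (λ _ → α))) (+-identityˡ α)

    cyclic-bottomLeft : C K zero ≈ β
    cyclic-bottomLeft = trans (+-congˡ (select-≡ (suc k) (λ _ → β))) (+-identityˡ β)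

    cyclic-elsewhere : ∀ i j → i ≢ j → j ≢ suc i → i ≢ suc j → ¬ (i ≡ 0 × j ≡ K) → ¬ (i ≡ K × j ≡ 0) → C i j ≈ 0#
    cyclic-elsewhere zero          zero          i≢j _ _ _ _ = ⊥-elim (i≢j ≡.refl)
    cyclic-elsewhere zero          (suc zero)    _ j≢1+i _ _ _ = ⊥-elim (j≢1+i ≡.refl)
    cyclic-elsewhere zero          (suc (suc j)) _ _ _ ¬0K _ =
      trans (+-congˡ (select-≢ K (λ _ → α) (suc (suc j)) (λ K≡ → ¬0K (≡.refl , ≡.sym K≡)))) (+-identityʳ 0#)
    cyclic-elsewhere (suc zero)    zero          _ _ i≢1+j _ _ = ⊥-elim (i≢1+j ≡.refl)
    cyclic-elsewhere (suc (suc i)) zero          _ _ _ _ ¬K0 =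
      trans (+-congˡ (select-≢ (suc k) (λ _ → β) (suc i) (λ k≡ → ¬K0 (≡.cong suc (≡.sym k≡) , ≡.refl)))) (+-identityʳ 0#)
    cyclic-elsewhere (suc i)       (suc j)       i≢j j≢1+i i≢1+j _ _ with ℕ.<-cmp i j
    ... | tri≈ _ i≡j _ = ⊥-elim (i≢j (≡.cong suc i≡j))
    ... | tri< i<j _ _ = reflexive (tridiagonal-farAbove x _ _ i j (ℕ.≤∧≢⇒< i<j (λ 1+i≡j → j≢1+i (≡.cong suc (≡.sym 1+i≡j)))))
    ... | tri> _ _ j<i = reflexive (tridiagonal-farBelow x _ _ i j (ℕ.≤∧≢⇒< j<i (λ 1+j≡i → i≢1+j (≡.cong suc (≡.sym 1+j≡i)))))

  private
    toℕ-punchIn-last : ∀ n (a : Fin n) → toℕ (punchIn (fromℕ n) a) ≡ toℕ a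
    toℕ-punchIn-last (suc n) zero    = ≡.refl
    toℕ-punchIn-last (suc n) (suc a) = ≡.cong suc (toℕ-punchIn-last n a)

    toℕ-inject₁< : ∀ {k} (i : Fin k) → toℕ (inject₁ i) ℕ.< k
    toℕ-inject₁< i = ≡.subst (ℕ._< _) (≡.sym (Fin.toℕ-inject₁ i)) (Fin.toℕ<n i)

    module CyclicMinors (k : ℕ) (x : Carrier) (u l : ℕ → Carrier) (α β : Carrier) where
      C : Matrix (suc (suc (suc k)))
      C a b = cyclic k x u l α β (toℕ a) (toℕ b)

      u′ l′ : ℕ → Carrier
      u′ i = u (suc i)
      l′ i = l (suc i)

      Pb Pc ΠU ΠL : Carrier
      Pb = continuant x (λ i → u (suc (suc i)) * l (suc (suc i))) (suc k)
      Pc = continuant x (λ i → u′ i * l′ i) (suc k)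
      ΠU = prodFin R (suc k) (λ i → u′ (toℕ i))
      ΠL = prodFin R (suc k) (λ i → l′ (toℕ i))

      firstColumnExpansion : ∀ (D : Matrix (suc (suc k))) → (∀ i → D i zero ≡ cyclic k x u l α β (suc (toℕ i)) zero) →
        det R (suc (suc k)) D ≈ l 0 * det R (suc k) (λ a b → D (suc a) (suc b))
           + sgn R (suc k) * (β * det R (suc k) (λ a b → D (punchIn (fromℕ (suc k)) a) (suc b)))
      firstColumnExpansion D D₀≡ = begin
        det R (suc (suc k)) D
          ≈⟨ det-columnExpansion (suc k) D ⟩
        columnTerm (suc k) D zero + sumFin R (suc k) (λ i → columnTerm (suc k) D (suc i))
          ≈⟨ +-congˡ (sumFin-last k (λ i → columnTerm (suc k) D (suc i))) ⟩
        columnTerm (suc k) D zero + (sumFin R k (λ i → columnTerm (suc k) D (suc (inject₁ i)))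
                                     + columnTerm (suc k) D (suc (fromℕ k)))
          ≈⟨ +-cong (trans (*-identityˡ _) (*-congʳ (trans (reflexive (D₀≡ zero)) (+-identityʳ (l 0)))))
               (+-cong (sumFin-0 k (λ i → trans (*-congˡ (*-congʳ (trans (reflexive (D₀≡ (suc (inject₁ i)))) (middle≈0 i))))
                                               (vanishingTerm _ _)))
                       (*-cong (reflexive (≡.cong (λ t → sgn R (suc t)) (Fin.toℕ-fromℕ k)))
                               (*-congʳ (trans (reflexive (D₀≡ (suc (fromℕ k)))) corner)))) ⟩
        l 0 * det R (suc k) (λ a b → D (suc a) (suc b))
          + (0# + sgn R (suc k) * (β * det R (suc k) (λ a b → D (punchIn (fromℕ (suc k)) a) (suc b))))
          ≈⟨ +-congˡ (+-identityˡ _) ⟩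
        _ ∎
        where
        middle≈0 : (i : Fin k) → cyclic k x u l α β (suc (suc (toℕ (inject₁ i)))) zero ≈ 0#
        middle≈0 i = trans (+-congˡ (select-≢ (suc k) (λ _ → β) (suc (toℕ (inject₁ i)))
                             (λ k≡ → ℕ.<-irrefl (ℕ.suc-injective (≡.sym k≡)) (toℕ-inject₁< i))))
                           (+-identityʳ 0#)
        corner : cyclic k x u l α β (suc (suc (toℕ (fromℕ k)))) zero ≈ β
        corner rewrite Fin.toℕ-fromℕ k = trans (+-congˡ (select-≡ (suc k) (λ _ → β))) (+-identityˡ β)

      minor₀₁ : det R (suc (suc k)) (λ a b → C (suc a) (punchIn (suc zero) b)) ≈ l 0 * Pb + sgn R (suc k) * (β * ΠU)
      minor₀₁ = trans (firstColumnExpansion (λ a b → C (suc a) (punchIn (suc zero) b)) (λ _ → ≡.refl))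
        (+-cong (*-congˡ (det-tridiagonal (suc k) x (λ i → u (suc (suc i))) (λ i → l (suc (suc i)))))
                (*-congˡ (*-congˡ upper)))
        where
        upper : det R (suc k) (λ a b → C (suc (punchIn (fromℕ (suc k)) a)) (punchIn (suc zero) (suc b))) ≈ ΠU
        upper = begin
          _ ≈⟨ det-cong (suc k) {N = λ a b → tridiagonal x u′ l′ (toℕ a) (suc (toℕ b))}
                 (λ a b → reflexive (≡.cong (λ t → tridiagonal x u′ l′ t (suc (toℕ b))) (toℕ-punchIn-last (suc k) a))) ⟩
          det R (suc k) (λ a b → tridiagonal x u′ l′ (toℕ a) (suc (toℕ b)))
            ≈⟨ det-lowerTriangular (suc k) _ (λ i j i<j → reflexive (tridiagonal-farAbove x u′ l′ (toℕ i) (suc (toℕ j)) (ℕ.s≤s i<j))) ⟩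
          prodFin R (suc k) (λ i → tridiagonal x u′ l′ (toℕ i) (suc (toℕ i)))
            ≈⟨ prodFin-cong (suc k) (λ i → reflexive (tridiagonal-above x u′ l′ (toℕ i))) ⟩
          ΠU ∎

      minor₀ₖ : det R (suc (suc k)) (λ a b → C (suc a) (punchIn (fromℕ (suc (suc k))) b)) ≈ l 0 * ΠL + sgn R (suc k) * (β * Pc)
      minor₀ₖ = trans (firstColumnExpansion (λ a b → C (suc a) (punchIn (fromℕ (suc (suc k))) b)) (λ _ → ≡.refl)) (+-cong (*-congˡ lower) (*-congˡ (*-congˡ inner)))
        where
        lower : det R (suc k) (λ a b → C (suc (suc a)) (punchIn (fromℕ (suc (suc k))) (suc b))) ≈ ΠL
        lower = begin
          _ ≈⟨ det-cong (suc k) {N = λ a b → tridiagonal x u′ l′ (suc (toℕ a)) (toℕ b)}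
                 (λ a b → reflexive (≡.cong (tridiagonal x u′ l′ (suc (toℕ a))) (toℕ-punchIn-last (suc k) b))) ⟩
          det R (suc k) (λ a b → tridiagonal x u′ l′ (suc (toℕ a)) (toℕ b))
            ≈⟨ det-upperTriangular (suc k) _ (λ i j j<i → reflexive (tridiagonal-farBelow x u′ l′ (suc (toℕ i)) (toℕ j) (ℕ.s≤s j<i))) ⟩
          prodFin R (suc k) (λ i → tridiagonal x u′ l′ (suc (toℕ i)) (toℕ i))
            ≈⟨ prodFin-cong (suc k) (λ i → reflexive (tridiagonal-below x u′ l′ (toℕ i))) ⟩
          ΠL ∎
        inner : det R (suc k) (λ a b → C (suc (punchIn (fromℕ (suc k)) a)) (punchIn (fromℕ (suc (suc k))) (suc b))) ≈ Pc
        inner = begin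
          _ ≈⟨ det-cong (suc k) {N = λ a b → tridiagonal x u′ l′ (toℕ a) (toℕ b)}
                 (λ a b → reflexive (≡.cong₂ (tridiagonal x u′ l′) (toℕ-punchIn-last (suc k) a) (toℕ-punchIn-last (suc k) b))) ⟩
          det R (suc k) (λ a b → tridiagonal x u′ l′ (toℕ a) (toℕ b))
            ≈⟨ det-tridiagonal (suc k) x u′ l′ ⟩
          Pc ∎

      firstRow-middle≈0 : (i : Fin k) → C zero (suc (suc (inject₁ i))) ≈ 0#
      firstRow-middle≈0 i = trans (+-congˡ (select-≢ (suc (suc k)) (λ _ → α) (suc (suc (toℕ (inject₁ i))))
                                   (λ k≡ → ℕ.<-irrefl (ℕ.suc-injective (ℕ.suc-injective (≡.sym k≡))) (toℕ-inject₁< i))))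
                                 (+-identityʳ 0#)

      firstRow-corner : C zero (suc (suc (fromℕ k))) ≈ α
      firstRow-corner rewrite Fin.toℕ-fromℕ k = trans (+-congˡ (select-≡ (suc (suc k)) (λ _ → α))) (+-identityˡ α)

  module _ (k : ℕ) (x : Carrier) (u l : ℕ → Carrier) (α β : Carrier) where
    open CyclicMinors k x u l α β

    -- The two sign-carrying terms are the two ways of going once around the cycle.
    det-cyclic : det R (suc (suc (suc k))) (λ a b → cyclic k x u l α β (toℕ a) (toℕ b)) ≈
      x * continuant x (λ i → u (suc i) * l (suc i)) (suc (suc k))
        - u 0 * l 0 * continuant x (λ i → u (suc (suc i)) * l (suc (suc i))) (suc k)
        - α * β * continuant x (λ i → u (suc i) * l (suc i)) (suc k)
        + sgn R (suc (suc k)) * (u 0 * prodFin R (suc k) (λ i → u (suc (toℕ i))) * β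
                                 + α * prodFin R (suc k) (λ i → l (suc (toℕ i))) * l 0)
    det-cyclic = begin
      det R (suc (suc (suc k))) C
        ≈⟨ +-congˡ (+-congˡ (sumFin-last k (λ i → rowTerm (suc (suc k)) C (suc (suc i))))) ⟩
      rowTerm (suc (suc k)) C zero + (rowTerm (suc (suc k)) C (suc zero) +
        (sumFin R k (λ i → rowTerm (suc (suc k)) C (suc (suc (inject₁ i)))) + rowTerm (suc (suc k)) C (suc (suc (fromℕ k)))))
        ≈⟨ +-cong (*-congˡ (*-congˡ (det-tridiagonal (suc (suc k)) x u′ l′)))
             (+-cong (*-congˡ (*-congˡ minor₀₁))
               (+-cong (sumFin-0 k (λ i → trans (*-congˡ (*-congʳ (firstRow-middle≈0 i))) (vanishingTerm _ _)))
                  (*-cong (reflexive (≡.cong (λ t → sgn R (suc (suc t))) (Fin.toℕ-fromℕ k))) (*-cong firstRow-corner minor₀ₖ)))) ⟩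
      1# * ((x + 0#) * Pa) + (sgn R 1 * ((u 0 + 0#) * (l 0 * Pb + s * (β * ΠU))) +
        (0# + (- 1# * s) * (α * (l 0 * ΠL + s * (β * Pc)))))
        ≈⟨ solve 11 (λ x Pa u₀ l₀ Pb s β ΠU α ΠL Pc →
              con (+ 1) :* ((x :+ con (+ 0)) :* Pa) :+ ((:- con (+ 1) :* con (+ 1)) :* ((u₀ :+ con (+ 0)) :* (l₀ :* Pb :+ s :* (β :* ΠU))) :+
                (con (+ 0) :+ (:- con (+ 1) :* s) :* (α :* (l₀ :* ΠL :+ s :* (β :* Pc)))))
              := x :* Pa :- u₀ :* l₀ :* Pb :- (s :* s) :* (α :* β :* Pc) :+ (:- con (+ 1) :* s) :* (u₀ :* ΠU :* β :+ α :* ΠL :* l₀))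
              refl x Pa (u 0) (l 0) Pb s β ΠU α ΠL Pc ⟩
      x * Pa - u 0 * l 0 * Pb - (s * s) * (α * β * Pc) + sgn R (suc (suc k)) * (u 0 * ΠU * β + α * ΠL * l 0)
        ≈⟨ +-congʳ (+-congˡ (-‿cong (trans (*-congʳ (sgn-square (suc k))) (*-identityˡ _)))) ⟩
      _ ∎
      where
      s  = sgn R (suc k)
      Pa = continuant x (λ i → u′ i * l′ i) (suc (suc k))

module CycleIndexing (k : ℕ) where

  N K : ℕ
  N = suc (suc (suc k))
  K = suc (suc k)

  ι : ℕ → Fin N
  ι i = i mod N

  toℕ-ι : ∀ {i} → i ℕ.< N → toℕ (ι i) ≡ i
  toℕ-ι i<N = ≡.trans (Fin.toℕ-fromℕ< _) (m<n⇒m%n≡m i<N)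

  ι-toℕ : ∀ (a : Fin N) → ι (toℕ a) ≡ a
  ι-toℕ a = Fin.toℕ-injective (toℕ-ι (Fin.toℕ<n a))

  toℕ-next : ∀ (a : Fin N) →
    (suc (toℕ a) ℕ.< N × toℕ (next a) ≡ suc (toℕ a)) ⊎ (toℕ a ≡ K × toℕ (next a) ≡ 0)
  toℕ-next a with suc (toℕ a) ℕ.≟ N
  ... | yes 1+a≡N = inj₂ (a≡K , ≡.trans (Fin.toℕ-fromℕ< _) (≡.trans (≡.cong (λ t → suc t % N) a≡K) (n%n≡0 N)))
    where a≡K = ℕ.suc-injective 1+a≡N
  ... | no  1+a≢N = inj₁ (1+a<N , ≡.trans (Fin.toℕ-fromℕ< _) (m<n⇒m%n≡m 1+a<N))
    where 1+a<N = ℕ.≤∧≢⇒< (Fin.toℕ<n a) 1+a≢N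

  next≢ : ∀ (a : Fin N) → a ≢ next a
  next≢ a a≡next with toℕ-next a
  ... | inj₁ (_ , n≡)      = ℕ.1+n≢n (≡.sym (≡.trans (≡.cong toℕ a≡next) n≡))
  ... | inj₂ (a≡K , n≡0)   with ≡.trans (≡.sym a≡K) (≡.trans (≡.cong toℕ a≡next) n≡0)
  ...   | ()

  next-injective : ∀ (a b : Fin N) → next a ≡ next b → a ≡ b
  next-injective a b na≡nb with toℕ-next a | toℕ-next b
  ... | inj₁ (_ , na) | inj₁ (_ , nb) =
    Fin.toℕ-injective (ℕ.suc-injective (≡.trans (≡.sym na) (≡.trans (≡.cong toℕ na≡nb) nb)))
  ... | inj₂ (a≡K , _) | inj₂ (b≡K , _) = Fin.toℕ-injective (≡.trans a≡K (≡.sym b≡K))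
  ... | inj₁ (_ , na) | inj₂ (_ , nb) with ≡.trans (≡.sym na) (≡.trans (≡.cong toℕ na≡nb) nb)
  ...   | ()
  next-injective a b na≡nb | inj₂ (_ , na) | inj₁ (_ , nb) with ≡.trans (≡.sym nb) (≡.trans (≡.cong toℕ (≡.sym na≡nb)) na)
  ...   | ()

  ==-≡ : ∀ {n} {a b : Fin n} → a ≡ b → (a == b) ≡ true
  ==-≡ {a = a} {b} = dec-true (a Fin.≟ b)

  ==-≢ : ∀ {n} {a b : Fin n} → a ≢ b → (a == b) ≡ false
  ==-≢ {a = a} {b} = dec-false (a Fin.≟ b)

  adj-next : ∀ (a : Fin N) → adj a (next a) ≡ true
  adj-next a rewrite ==-≡ {a = next a} ≡.refl = ≡.refl

  adj-prev : ∀ (a : Fin N) → adj (next a) a ≡ true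
  adj-prev a rewrite ==-≡ {a = next a} ≡.refl = Bool.∨-zeroʳ _

  adj-nonadjacent : ∀ {a b : Fin N} → b ≢ next a → a ≢ next b → adj a b ≡ false
  adj-nonadjacent b≢ a≢ rewrite ==-≢ b≢ | ==-≢ a≢ = ≡.refl

module CyclicAdjacencyMatrix {c ℓ} (R : CommutativeRing c ℓ) (k : ℕ) (x : CommutativeRing.Carrier R)
                             (φ : Fin (suc (suc (suc k))) → Fin (suc (suc (suc k))) → CommutativeRing.Carrier R) where
  open CommutativeRing R hiding (zero)
  open import Relation.Binary.Reasoning.Setoid setoid
  open import Algebra.Properties.Ring ring using (-0#≈0#)
  open Determinant R
  open CycleIndexing k

  u l : ℕ → Carrier
  u i = - φ (ι i) (next (ι i))
  l i = - φ (next (ι i)) (ι i)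

  C : ℕ → ℕ → Carrier
  C = cyclic k x u l (l K) (u K)

  private
    ι-K : ∀ {a : Fin N} → toℕ a ≡ K → ι K ≡ a
    ι-K {a} a≡K = ≡.trans (≡.cong ι (≡.sym a≡K)) (ι-toℕ a)

  cyclic-next : ∀ a → C (toℕ a) (toℕ (next a)) ≈ - φ a (next a)
  cyclic-next a with toℕ-next a
  ... | inj₁ (_ , n≡) rewrite n≡ =
    trans (cyclic-above k x u l (l K) (u K) (toℕ a)) (reflexive (≡.cong (λ b → - φ b (next b)) (ι-toℕ a)))
  ... | inj₂ (a≡K , n≡0) rewrite n≡0 =
    trans (reflexive (≡.cong (λ i → C i 0) a≡K))
          (trans (cyclic-bottomLeft k x u l (l K) (u K)) (reflexive (≡.cong (λ b → - φ b (next b)) (ι-K a≡K))))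

  cyclic-prev : ∀ b → C (toℕ (next b)) (toℕ b) ≈ - φ (next b) b
  cyclic-prev b with toℕ-next b
  ... | inj₁ (_ , n≡) rewrite n≡ =
    trans (cyclic-below k x u l (l K) (u K) (toℕ b)) (reflexive (≡.cong (λ a → - φ (next a) a) (ι-toℕ b)))
  ... | inj₂ (b≡K , n≡0) rewrite n≡0 =
    trans (reflexive (≡.cong (C 0) b≡K))
          (trans (cyclic-topRight k x u l (l K) (u K)) (reflexive (≡.cong (λ a → - φ (next a) a) (ι-K b≡K))))

  cyclic-nonadjacent : ∀ {a b} → a ≢ b → b ≢ next a → a ≢ next b → C (toℕ a) (toℕ b) ≈ 0#
  cyclic-nonadjacent {a} {b} a≢b b≢ a≢ = cyclic-elsewhere k x u l (l K) (u K) (toℕ a) (toℕ b)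
    (λ e → a≢b (Fin.toℕ-injective e))
    (λ e → b≢ (successor e)) (λ e → a≢ (successor e))
    (λ (a≡0 , b≡K) → a≢ (wrap b≡K a≡0)) (λ (a≡K , b≡0) → b≢ (wrap a≡K b≡0))
    where
    successor : ∀ {a b : Fin N} → toℕ b ≡ suc (toℕ a) → b ≡ next a
    successor {a} {b} e with toℕ-next a
    ... | inj₁ (_ , n≡)   = Fin.toℕ-injective (≡.trans e (≡.sym n≡))
    ... | inj₂ (a≡K , _) = ⊥-elim (ℕ.<-irrefl (≡.trans e (≡.cong suc a≡K)) (Fin.toℕ<n b))
    wrap : ∀ {a b : Fin N} → toℕ a ≡ K → toℕ b ≡ 0 → b ≡ next a
    wrap {a} a≡K b≡0 with toℕ-next a
    ... | inj₁ (1+a<N , _) = ⊥-elim (ℕ.<-irrefl ≡.refl (≡.subst (λ t → suc t ℕ.< N) a≡K 1+a<N))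
    ... | inj₂ (_ , n≡0)   = Fin.toℕ-injective (≡.trans b≡0 (≡.sym n≡0))

  private
    entry≡ : ∀ {a b : Fin N} {e₁ e₂} → (a == b) ≡ e₁ → adj a b ≡ e₂ →
      (if a == b then x else 0#) - adjMatrix R N φ a b ≡ (if e₁ then x else 0#) - (if e₂ then φ a b else 0#)
    entry≡ ≡.refl ≡.refl = ≡.refl

    entry≈ : ∀ a b → Dec (a ≡ b) → Dec (b ≡ next a) → Dec (a ≡ next b) →
      (if a == b then x else 0#) - adjMatrix R N φ a b ≈ C (toℕ a) (toℕ b)
    entry≈ a .a (yes ≡.refl) _ _ = begin
      _      ≡⟨ entry≡ (==-≡ {a = a} ≡.refl) (adj-nonadjacent (next≢ a) (next≢ a)) ⟩
      x - 0# ≈⟨ trans (+-congˡ -0#≈0#) (+-identityʳ x) ⟩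
      x      ≈⟨ cyclic-diagonal k x u l (l K) (u K) (toℕ a) ⟨
      C (toℕ a) (toℕ a) ∎
    entry≈ a .(next a) (no a≢b) (yes ≡.refl) _ = begin
      _                 ≡⟨ entry≡ (==-≢ a≢b) (adj-next a) ⟩
      0# - φ a (next a) ≈⟨ +-identityˡ _ ⟩
      - φ a (next a)    ≈⟨ cyclic-next a ⟨
      C (toℕ a) (toℕ (next a)) ∎
    entry≈ .(next b) b (no a≢b) (no _) (yes ≡.refl) = begin
      _                 ≡⟨ entry≡ (==-≢ a≢b) (adj-prev b) ⟩
      0# - φ (next b) b ≈⟨ +-identityˡ _ ⟩
      - φ (next b) b    ≈⟨ cyclic-prev b ⟨
      C (toℕ (next b)) (toℕ b) ∎
    entry≈ a b (no a≢b) (no b≢) (no a≢) = begin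
      _       ≡⟨ entry≡ (==-≢ a≢b) (adj-nonadjacent b≢ a≢) ⟩
      0# - 0# ≈⟨ -‿inverseʳ 0# ⟩
      0#      ≈⟨ cyclic-nonadjacent a≢b b≢ a≢ ⟨
      C (toℕ a) (toℕ b) ∎

  Ψ≈det-cyclic : Ψ R N φ x ≈ det R N (λ a b → C (toℕ a) (toℕ b))
  Ψ≈det-cyclic = det-cong N (λ a b → entry≈ a b (a Fin.≟ b) (b Fin.≟ next a) (a Fin.≟ next b))

-- For an edge set t of a path, the flags say whether the edges just beyond its two ends are chosen
-- as well; admissible holds when all chosen edges together form a matching.
admissible : Bool → Bool → ∀ {m} → Vec Bool m → Bool
admissible before after []          = not (before ∧ after)
admissible before after (false ∷ t) = admissible false after t
admissible before after (true ∷ t)  = not before ∧ admissible true after t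

uncovered : Bool → Bool → ∀ {m} → Vec Bool m → ℕ
uncovered before after []          = if before ∨ after then 0 else 1
uncovered before after (false ∷ t) = (if before then 0 else 1) ℕ.+ uncovered false after t
uncovered before after (true ∷ t)  = uncovered true after t

bit : Bool → ℕ
bit true  = 1
bit false = 0

-- A path with m edges has suc m vertices: each is uncovered, covered by one of its ∣ t ∣ matched
-- edges (two vertices each), or covered by the edge before or after.
uncovered-count : ∀ before after {m} (t : Vec Bool m) → admissible before after t ≡ true →
  uncovered before after t ℕ.+ (∣ t ∣ ℕ.+ ∣ t ∣) ℕ.+ bit before ℕ.+ bit after ≡ suc m
uncovered-count false false []          _  = ≡.refl
uncovered-count false true  []          _  = ≡.refl
uncovered-count true  false []          _  = ≡.refl
uncovered-count true  true  []          ()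
uncovered-count false after (false ∷ t) ok = ≡.cong suc (uncovered-count false after t ok)
uncovered-count true  after (false ∷ t) ok = ≡.trans (lemma (uncovered false after t) (∣ t ∣ ℕ.+ ∣ t ∣) (bit after))
                                                    (≡.cong suc (uncovered-count false after t ok))
  where
  lemma : ∀ v s w → v ℕ.+ s ℕ.+ 1 ℕ.+ w ≡ suc (v ℕ.+ s ℕ.+ 0 ℕ.+ w)
  lemma = solve-∀
uncovered-count false after (true ∷ t)  ok = ≡.trans (lemma (uncovered true after t) ∣ t ∣ (bit after))
                                                    (≡.cong suc (uncovered-count true after t ok))
  where
  lemma : ∀ v s w → v ℕ.+ (suc s ℕ.+ suc s) ℕ.+ 0 ℕ.+ w ≡ suc (v ℕ.+ (s ℕ.+ s) ℕ.+ 1 ℕ.+ w)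
  lemma = solve-∀
uncovered-count true  after (true ∷ t)  ()

admissible-empty : ∀ m → admissible false false (replicate m false) ≡ true
admissible-empty zero    = ≡.refl
admissible-empty (suc m) = admissible-empty m

module PathMatchings {c ℓ} (R : CommutativeRing c ℓ) (x : CommutativeRing.Carrier R) where
  open CommutativeRing R hiding (zero)
  open import Relation.Binary.Reasoning.Setoid setoid
  open IntegerCoefficients R using (solve; _:=_; _:*_; :-_; con)
  open FiniteSums R
  open Determinant R using (continuant)
  open import Algebra.Properties.Ring ring using (-‿distribˡ-*)

  -- The path is read vertex by vertex: an uncovered vertex contributes x, a chosen edge − h i.
  pathTerm : Bool → Bool → (ℕ → Carrier) → ∀ {m} → Vec Bool m → Carrier
  pathTerm before after h []          = if before then (if after then 0# else 1#) else (if after then 1# else x)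
  pathTerm before after h (false ∷ t) = (if before then 1# else x) * pathTerm false after (λ i → h (suc i)) t
  pathTerm before after h (true ∷ t)  = if before then 0# else (- h 0 * pathTerm true after (λ i → h (suc i)) t)

  sumSubset-pathTerm-ff : ∀ m h → sumSubset m (pathTerm false false h) ≈ continuant x h (suc m)
  sumSubset-pathTerm-tf : ∀ m h → sumSubset m (pathTerm true false h) ≈ continuant x (λ i → h (suc i)) m

  sumSubset-pathTerm-ff zero    h = refl
  sumSubset-pathTerm-ff (suc m) h = begin
    sumSubset m (λ t → x * pathTerm false false h′ t) + sumSubset m (λ t → - h 0 * pathTerm true false h′ t)
      ≈⟨ +-cong (sumSubset-*ˡ m x (pathTerm false false h′)) (sumSubset-*ˡ m (- h 0) (pathTerm true false h′)) ⟨
    x * sumSubset m (pathTerm false false h′) + - h 0 * sumSubset m (pathTerm true false h′)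
      ≈⟨ +-cong (*-congˡ (sumSubset-pathTerm-ff m h′)) (*-congˡ (sumSubset-pathTerm-tf m h′)) ⟩
    x * continuant x h′ (suc m) + - h 0 * continuant x (λ i → h (suc (suc i))) m
      ≈⟨ +-congˡ (-‿distribˡ-* (h 0) _) ⟨
    continuant x h (suc (suc m)) ∎
    where h′ = λ i → h (suc i)
  sumSubset-pathTerm-tf zero    h = refl
  sumSubset-pathTerm-tf (suc m) h =
    trans (+-cong (trans (sym (sumSubset-*ˡ m 1# (pathTerm false false (λ i → h (suc i))))) (*-identityˡ _))
                  (sumSubset-0 m (λ _ → refl)))
          (trans (+-identityʳ _) (sumSubset-pathTerm-ff m (λ i → h (suc i))))

  sumSubset-pathTerm-ft : ∀ m h → sumSubset m (pathTerm false true h) ≈ continuant x h m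
  sumSubset-pathTerm-ft zero          h = refl
  sumSubset-pathTerm-ft (suc zero)    h = trans (+-cong (*-identityʳ x) (zeroʳ _)) (+-identityʳ x)
  sumSubset-pathTerm-ft (suc (suc m)) h = begin
    sumSubset (suc m) (λ t → x * pathTerm false true h′ t) + sumSubset (suc m) (λ t → - h 0 * pathTerm true true h′ t)
      ≈⟨ +-cong (sumSubset-*ˡ (suc m) x (pathTerm false true h′)) (sumSubset-*ˡ (suc m) (- h 0) (pathTerm true true h′)) ⟨
    x * sumSubset (suc m) (pathTerm false true h′)
      + - h 0 * (sumSubset m (λ t → 1# * pathTerm false true h″ t) + sumSubset m (λ _ → 0#))
      ≈⟨ +-congˡ (*-congˡ (trans (+-cong (trans (sym (sumSubset-*ˡ m 1# (pathTerm false true h″))) (*-identityˡ _))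
                                         (sumSubset-0 m (λ _ → refl)))
                                 (+-identityʳ _))) ⟩
    x * sumSubset (suc m) (pathTerm false true h′) + - h 0 * sumSubset m (pathTerm false true h″)
      ≈⟨ +-cong (*-congˡ (sumSubset-pathTerm-ft (suc m) h′)) (*-congˡ (sumSubset-pathTerm-ft m h″)) ⟩
    x * continuant x h′ (suc m) + - h 0 * continuant x h″ m
      ≈⟨ +-congˡ (-‿distribˡ-* (h 0) _) ⟨
    continuant x h (suc (suc m)) ∎
    where
    h′ = λ i → h (suc i)
    h″ = λ i → h (suc (suc i))

  weight : (ℕ → Carrier) → ∀ {m} → Vec Bool m → Carrier
  weight h []      = 1#
  weight h (b ∷ t) = (if b then h 0 else 1#) * weight (λ i → h (suc i)) t

  pathTerm-closedForm : ∀ before after h {m} (t : Vec Bool m) → pathTerm before after h t ≈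
    (if admissible before after t then sgn R ∣ t ∣ * (weight h t * pow R x (uncovered before after t)) else 0#)
  pathTerm-closedForm false false h []     = solve 1 (λ x → x := con (+ 1) :* (con (+ 1) :* (x :* con (+ 1)))) refl x
  pathTerm-closedForm false true  h []     = solve 0 (con (+ 1) := con (+ 1) :* (con (+ 1) :* con (+ 1))) refl
  pathTerm-closedForm true  false h []     = solve 0 (con (+ 1) := con (+ 1) :* (con (+ 1) :* con (+ 1))) refl
  pathTerm-closedForm true  true  h []     = refl
  pathTerm-closedForm true  after h (true ∷ t) = refl
  pathTerm-closedForm false after h (false ∷ t) with admissible false after t | pathTerm-closedForm false after (λ i → h (suc i)) t
  ... | true  | ih = trans (*-congˡ ih)
    (solve 4 (λ x s w p → x :* (s :* (w :* p)) := s :* ((con (+ 1) :* w) :* (x :* p))) refl x _ _ _)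
  ... | false | ih = trans (*-congˡ ih) (zeroʳ x)
  pathTerm-closedForm true  after h (false ∷ t) with admissible false after t | pathTerm-closedForm false after (λ i → h (suc i)) t
  ... | true  | ih = trans (*-congˡ ih)
    (solve 3 (λ s w p → con (+ 1) :* (s :* (w :* p)) := s :* ((con (+ 1) :* w) :* p)) refl _ _ _)
  ... | false | ih = trans (*-congˡ ih) (zeroʳ _)
  pathTerm-closedForm false after h (true ∷ t) with admissible true after t | pathTerm-closedForm true after (λ i → h (suc i)) t
  ... | true  | ih = trans (*-congˡ ih)
    (solve 4 (λ a s w p → (:- a) :* (s :* (w :* p)) := (:- con (+ 1) :* s) :* ((a :* w) :* p)) refl (h 0) _ _ _)
  ... | false | ih = trans (*-congˡ ih) (zeroʳ _)

  weight-empty : ∀ m h → weight h (replicate m false) ≈ 1#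
  weight-empty zero    h = refl
  weight-empty (suc m) h = trans (*-identityˡ _) (weight-empty m (λ i → h (suc i)))

∧-true₁ : ∀ {a b} → a ∧ b ≡ true → a ≡ true
∧-true₁ {true} _ = ≡.refl

∧-true₂ : ∀ {a b} → a ∧ b ≡ true → b ≡ true
∧-true₂ {true} ab = ab

allᵇ-map : ∀ {A B : Set} (p : B → Bool) (g : A → B) (as : List A) → allᵇ p (map g as) ≡ allᵇ (λ a → p (g a)) as
allᵇ-map p g []       = ≡.refl
allᵇ-map p g (a ∷ as) = ≡.cong (p (g a) ∧_) (allᵇ-map p g as)

allᵇ-allFinL⁻ : ∀ n (p : Fin n → Bool) → allᵇ p (allFinL n) ≡ true → ∀ i → p i ≡ true
allᵇ-allFinL⁻ (suc n) p all zero    = ∧-true₁ all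
allᵇ-allFinL⁻ (suc n) p all (suc i) =
  allᵇ-allFinL⁻ n (λ j → p (suc j)) (≡.trans (≡.sym (allᵇ-map p suc (allFinL n))) (∧-true₂ {p zero} all)) i

allᵇ-allFinL⁺ : ∀ n (p : Fin n → Bool) → (∀ i → p i ≡ true) → allᵇ p (allFinL n) ≡ true
allᵇ-allFinL⁺ zero    p _   = ≡.refl
allᵇ-allFinL⁺ (suc n) p all rewrite all zero | allᵇ-map p suc (allFinL n) = allᵇ-allFinL⁺ n (λ j → p (suc j)) (λ i → all (suc i))

framed : Bool → ∀ {m} → Vec Bool m → Bool → ℕ → Bool
framed before t           after zero    = before
framed before []          after (suc p) = after
framed before (b ∷ t)     after (suc p) = framed b t after p

framed-lookup : ∀ before {m} (t : Vec Bool m) after (i : Fin (suc m)) →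
  framed before t after (toℕ i) ≡ lookup (before ∷ t) i
framed-lookup before t       after zero    = ≡.refl
framed-lookup before (b ∷ t) after (suc i) = framed-lookup b t after i

framed-end : ∀ before {m} (t : Vec Bool m) after → framed before t after (suc m) ≡ after
framed-end before []      after = ≡.refl
framed-end before (b ∷ t) after = framed-end b t after

NoTwoInARow : (ℕ → Bool) → ℕ → Set
NoTwoInARow f m = ∀ p → p ≤ m → f p ≡ true → f (suc p) ≡ true → ⊥

admissible⇒NoTwoInARow : ∀ before after {m} (t : Vec Bool m) → admissible before after t ≡ true →
  NoTwoInARow (framed before t after) m
admissible⇒NoTwoInARow true  true  []          () zero    _ ≡.refl ≡.refl
admissible⇒NoTwoInARow before after []          _  (suc p) () _ _
admissible⇒NoTwoInARow before after (false ∷ t) _  zero    _ _ ()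
admissible⇒NoTwoInARow before after (false ∷ t) ok (suc p) (s≤s p≤m) =
  admissible⇒NoTwoInARow false after t ok p p≤m
admissible⇒NoTwoInARow true  after (true ∷ t)  () zero _ ≡.refl _
admissible⇒NoTwoInARow before after (true ∷ t)  ok (suc p) (s≤s p≤m) =
  admissible⇒NoTwoInARow true after t (∧-true₂ {not before} ok) p p≤m

NoTwoInARow⇒admissible : ∀ before after {m} (t : Vec Bool m) → NoTwoInARow (framed before t after) m →
  admissible before after t ≡ true
NoTwoInARow⇒admissible false after []          _  = ≡.refl
NoTwoInARow⇒admissible true  false []          _  = ≡.refl
NoTwoInARow⇒admissible true  true  []          none = ⊥-elim (none zero z≤n ≡.refl ≡.refl)
NoTwoInARow⇒admissible before after (false ∷ t) none =
  NoTwoInARow⇒admissible false after t (λ p p≤m → none (suc p) (s≤s p≤m))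
NoTwoInARow⇒admissible false after (true ∷ t)  none =
  NoTwoInARow⇒admissible true after t (λ p p≤m → none (suc p) (s≤s p≤m))
NoTwoInARow⇒admissible true  after (true ∷ t)  none = ⊥-elim (none zero z≤n ≡.refl ≡.refl)

module CycleMatchings (k : ℕ) where
  open CycleIndexing k

  NoConsecutive : Vec Bool N → Set
  NoConsecutive s = ∀ i → lookup s i ≡ true → lookup s (next i) ≡ true → ⊥

  private
    disjoint-check : Vec Bool N → Fin N → Fin N → Bool
    disjoint-check s i j = not (lookup s i ∧ lookup s j ∧ not (i == j)) ∨ disjointᵇ i j

  isMatchingᵇ⇒NoConsecutive : ∀ s → isMatchingᵇ s ≡ true → NoConsecutive s
  isMatchingᵇ⇒NoConsecutive s matching i sᵢ sₙ = false≢true (≡.trans (≡.sym check≡false) check≡true)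
    where
    check≡true : disjoint-check s i (next i) ≡ true
    check≡true = allᵇ-allFinL⁻ N (disjoint-check s i)
      (allᵇ-allFinL⁻ N (λ i → allᵇ (disjoint-check s i) (allFinL N)) matching i) (next i)
    check≡false : disjoint-check s i (next i) ≡ false
    check≡false rewrite sᵢ | sₙ | ==-≢ (next≢ i) | ==-≡ {a = next i} ≡.refl | Bool.∨-zeroʳ (i == next (next i)) = ≡.refl
    false≢true : false ≡ true → ⊥
    false≢true ()

  NoConsecutive⇒isMatchingᵇ : ∀ s → NoConsecutive s → isMatchingᵇ s ≡ true
  NoConsecutive⇒isMatchingᵇ s noCons = allᵇ-allFinL⁺ N (λ i → allᵇ (disjoint-check s i) (allFinL N))
    (λ i → allᵇ-allFinL⁺ N (disjoint-check s i) (check i))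
    where
    check : ∀ i j → disjoint-check s i j ≡ true
    check i j with lookup s i in sᵢ | lookup s j in sⱼ | i Fin.≟ j
    ... | false | _     | _        = ≡.refl
    ... | true  | false | _        = ≡.refl
    ... | true  | true  | yes _    = ≡.refl
    ... | true  | true  | no  i≢j
      rewrite ==-≢ {a = i} {next j} (λ e → noCons j sⱼ (≡.subst (λ z → lookup s z ≡ true) e sᵢ))
            | ==-≢ {a = next i} {j} (λ e → noCons i sᵢ (≡.subst (λ z → lookup s z ≡ true) (≡.sym e) sⱼ))
            | ==-≢ {a = next i} {next j} (λ e → i≢j (next-injective i j e)) = ≡.refl

  private
    framed-next : ∀ b (t : Vec Bool K) (i : Fin N) → framed b t b (suc (toℕ i)) ≡ lookup (b ∷ t) (next i)
    framed-next b t i with toℕ-next i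
    ... | inj₁ (_ , n≡) = ≡.trans (≡.cong (framed b t b) (≡.sym n≡)) (framed-lookup b t b (next i))
    ... | inj₂ (i≡K , n≡0) = ≡.trans (≡.cong (λ p → framed b t b (suc p)) i≡K)
      (≡.trans (framed-end b t b) (≡.cong (lookup (b ∷ t)) (Fin.toℕ-injective {j = next i} (≡.sym n≡0))))

  cyclicAdmissible : Vec Bool N → Bool
  cyclicAdmissible (b ∷ t) = admissible b b t

  NoConsecutive⇒cyclicAdmissible : ∀ s → NoConsecutive s → cyclicAdmissible s ≡ true
  NoConsecutive⇒cyclicAdmissible (b ∷ t) noCons = NoTwoInARow⇒admissible b b t twoInARow⇒⊥
    where
    twoInARow⇒⊥ : NoTwoInARow (framed b t b) K
    twoInARow⇒⊥ p p≤K fₚ f₁₊ₚ = noCons i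
      (≡.trans (≡.sym (framed-lookup b t b i)) (≡.subst (λ q → framed b t b q ≡ true) (≡.sym toℕ-i) fₚ))
      (≡.trans (≡.sym (framed-next b t i)) (≡.subst (λ q → framed b t b (suc q) ≡ true) (≡.sym toℕ-i) f₁₊ₚ))
      where
      i : Fin N
      i = Fin.fromℕ< (s≤s p≤K)
      toℕ-i : toℕ i ≡ p
      toℕ-i = Fin.toℕ-fromℕ< (s≤s p≤K)

  cyclicAdmissible⇒NoConsecutive : ∀ s → cyclicAdmissible s ≡ true → NoConsecutive s
  cyclicAdmissible⇒NoConsecutive (b ∷ t) ok i sᵢ sₙ =
    admissible⇒NoTwoInARow b b t ok (toℕ i) (ℕ.≤-pred (Fin.toℕ<n i))
      (≡.trans (framed-lookup b t b i) sᵢ) (≡.trans (framed-next b t i) sₙ)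

  isMatchingᵇ≡cyclicAdmissible : ∀ s → isMatchingᵇ s ≡ cyclicAdmissible s
  isMatchingᵇ≡cyclicAdmissible s = Bool.⇔→≡ {z = true} (mk⇔
    (λ m → NoConsecutive⇒cyclicAdmissible s (isMatchingᵇ⇒NoConsecutive s m))
    (λ a → NoConsecutive⇒isMatchingᵇ s (cyclicAdmissible⇒NoConsecutive s a)))

  uncovered+2∣s∣ : ∀ b (t : Vec Bool K) → admissible b b t ≡ true → uncovered b b t ℕ.+ 2 ℕ.* ∣ b ∷ t ∣ ≡ N
  uncovered+2∣s∣ false t ok = ≡.trans (lemma (uncovered false false t) ∣ t ∣) (uncovered-count false false t ok)
    where
    lemma : ∀ u s → u ℕ.+ 2 ℕ.* s ≡ u ℕ.+ (s ℕ.+ s) ℕ.+ 0 ℕ.+ 0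
    lemma = solve-∀
  uncovered+2∣s∣ true  t ok = ≡.trans (lemma (uncovered true true t) ∣ t ∣) (uncovered-count true true t ok)
    where
    lemma : ∀ u s → u ℕ.+ 2 ℕ.* suc s ≡ u ℕ.+ (s ℕ.+ s) ℕ.+ 1 ℕ.+ 1
    lemma = solve-∀

  uncovered≡ : ∀ b (t : Vec Bool K) → admissible b b t ≡ true → N ℕ.∸ 2 ℕ.* ∣ b ∷ t ∣ ≡ uncovered b b t
  uncovered≡ b t ok = ≡.trans (≡.cong (ℕ._∸ 2 ℕ.* ∣ b ∷ t ∣) (≡.sym (uncovered+2∣s∣ b t ok))) (ℕ.m+n∸n≡m (uncovered b b t) (2 ℕ.* ∣ b ∷ t ∣))

  cyclicAdmissible⇒∣s∣≤N/2 : ∀ s → cyclicAdmissible s ≡ true → ∣ s ∣ ℕ.≤ N / 2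
  cyclicAdmissible⇒∣s∣≤N/2 (b ∷ t) ok = begin
    ∣ b ∷ t ∣               ≡⟨ m*n/n≡m ∣ b ∷ t ∣ 2 ⟨
    ∣ b ∷ t ∣ ℕ.* 2 / 2     ≤⟨ /-monoˡ-≤ 2 (begin
                               ∣ b ∷ t ∣ ℕ.* 2                        ≡⟨ ℕ.*-comm ∣ b ∷ t ∣ 2 ⟩
                               2 ℕ.* ∣ b ∷ t ∣                        ≤⟨ ℕ.m≤n+m _ (uncovered b b t) ⟩
                               uncovered b b t ℕ.+ 2 ℕ.* ∣ b ∷ t ∣    ≡⟨ uncovered+2∣s∣ b t ok ⟩
                               N ∎) ⟩
    N / 2 ∎
    where open ℕ.≤-Reasoning

module CycleMatchingPolynomial {c ℓ} (R : CommutativeRing c ℓ) (k : ℕ) (x : CommutativeRing.Carrier R)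
  (f : CommutativeRing.Carrier R → CommutativeRing.Carrier R)
  (φ : Fin (suc (suc (suc k))) → Fin (suc (suc (suc k))) → CommutativeRing.Carrier R) where
  open CommutativeRing R hiding (zero)
  open import Relation.Binary.Reasoning.Setoid setoid
  open IntegerCoefficients R using (solve; _:=_; _:*_; :-_; con)
  open FiniteSums R
  open Determinant R using (continuant)
  open import Algebra.Properties.Ring ring using (-‿distribˡ-*)
  open PathMatchings R x
  open CycleIndexing k
  open CycleMatchings k

  g : ℕ → Carrier
  g i = gmap R f (φ (ι i) (next (ι i)))

  matchingWeight : Vec Bool N → Carrier
  matchingWeight s = prodFin R N (λ i → if lookup s i then gmap R f (φ i (next i)) else 1#)

  matchingTerm : ℕ → Vec Bool N → Carrier
  matchingTerm j s = sgn R j * (matchingWeight s * pow R x (N ℕ.∸ (2 ℕ.* j)))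

  -- Cutting the cycle open at the edge v₀v₁: either it is unmatched, or it is matched and
  -- then both of its neighbouring edges are not.
  cycleTerm : Vec Bool N → Carrier
  cycleTerm (b ∷ t) = (if b then - g 0 else 1#) * pathTerm b b (λ i → g (suc i)) t

  private
    prodFin-select : ∀ {n} (s : Vec Bool n) (h : ℕ → Carrier) →
      prodFin R n (λ i → if lookup s i then h (toℕ i) else 1#) ≈ weight h s
    prodFin-select []      h = refl
    prodFin-select (b ∷ s) h = *-congˡ (prodFin-select s (λ i → h (suc i)))

  matchingWeight≈weight : ∀ s → matchingWeight s ≈ weight g s
  matchingWeight≈weight s = trans
    (prodFin-cong N (λ i → reflexive (≡.cong (λ a → if lookup s i then gmap R f (φ a (next a)) else 1#) (≡.sym (ι-toℕ i)))))
    (prodFin-select s g)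

  cycleTerm-closedForm : ∀ s → (if cyclicAdmissible s then matchingTerm ∣ s ∣ s else 0#) ≈ cycleTerm s
  cycleTerm-closedForm (false ∷ t) with admissible false false t in ok | pathTerm-closedForm false false (λ i → g (suc i)) t
  ... | false | closed = sym (trans (*-congˡ closed) (zeroʳ _))
  ... | true  | closed = begin
    sgn R ∣ t ∣ * (matchingWeight (false ∷ t) * pow R x (N ℕ.∸ 2 ℕ.* ∣ t ∣))
      ≈⟨ *-congˡ (*-cong (matchingWeight≈weight (false ∷ t)) (reflexive (≡.cong (pow R x) (uncovered≡ false t ok)))) ⟩
    sgn R ∣ t ∣ * ((1# * weight g′ t) * pow R x (uncovered false false t))
      ≈⟨ solve 3 (λ s w p → s :* ((con (+ 1) :* w) :* p) := con (+ 1) :* (s :* (w :* p))) refl _ _ _ ⟩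
    1# * (sgn R ∣ t ∣ * (weight g′ t * pow R x (uncovered false false t)))
      ≈⟨ *-congˡ closed ⟨
    cycleTerm (false ∷ t) ∎
    where g′ = λ i → g (suc i)
  cycleTerm-closedForm (true ∷ t) with admissible true true t in ok | pathTerm-closedForm true true (λ i → g (suc i)) t
  ... | false | closed = sym (trans (*-congˡ closed) (zeroʳ _))
  ... | true  | closed = begin
    sgn R (suc ∣ t ∣) * (matchingWeight (true ∷ t) * pow R x (N ℕ.∸ 2 ℕ.* suc ∣ t ∣))
      ≈⟨ *-congˡ (*-cong (matchingWeight≈weight (true ∷ t)) (reflexive (≡.cong (pow R x) (uncovered≡ true t ok)))) ⟩
    (- 1# * sgn R ∣ t ∣) * ((g 0 * weight g′ t) * pow R x (uncovered true true t))
      ≈⟨ solve 4 (λ a s w p → (:- con (+ 1) :* s) :* ((a :* w) :* p) := (:- a) :* (s :* (w :* p))) refl (g 0) _ _ _ ⟩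
    - g 0 * (sgn R ∣ t ∣ * (weight g′ t * pow R x (uncovered true true t)))
      ≈⟨ *-congˡ closed ⟨
    cycleTerm (true ∷ t) ∎
    where g′ = λ i → g (suc i)

  private
    sizedTerm : ℕ → Vec Bool N → Carrier
    sizedTerm j s = if isMatchingᵇ s ∧ does (∣ s ∣ ℕ.≟ j) then matchingTerm j s else 0#

    emptyTerm : Vec Bool N → Carrier
    emptyTerm s = if does (∣ s ∣ ℕ.≟ 0) then (if cyclicAdmissible s then matchingTerm 0 s else 0#) else 0#

    coefficient≈sumSubset : ∀ j → sgn R j * (a2k R f N φ j * pow R x (N ℕ.∸ 2 ℕ.* j)) ≈ sumSubset N (sizedTerm j)
    coefficient≈sumSubset j = begin
      sgn R j * (a2k R f N φ j * xᵖ)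
        ≈⟨ *-congˡ (*-congʳ (trans (sumL-filterᵇ p matchingWeight (allSubsets N)) (sumL-allSubsets N _))) ⟩
      sgn R j * (sumSubset N (λ s → if p s then matchingWeight s else 0#) * xᵖ)
        ≈⟨ *-congˡ (sumSubset-*ʳ N xᵖ (λ s → if p s then matchingWeight s else 0#)) ⟩
      sgn R j * sumSubset N (λ s → (if p s then matchingWeight s else 0#) * xᵖ)
        ≈⟨ sumSubset-*ˡ N (sgn R j) (λ s → (if p s then matchingWeight s else 0#) * xᵖ) ⟩
      sumSubset N (λ s → sgn R j * ((if p s then matchingWeight s else 0#) * xᵖ))
        ≈⟨ sumSubset-cong N (λ s → if-factor (p s) (matchingWeight s)) ⟩
      sumSubset N (sizedTerm j) ∎
      where
      xᵖ = pow R x (N ℕ.∸ 2 ℕ.* j)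
      p : Vec Bool N → Bool
      p s = isMatchingᵇ s ∧ does (∣ s ∣ ℕ.≟ j)
      if-factor : ∀ b w → sgn R j * ((if b then w else 0#) * xᵖ) ≈ (if b then sgn R j * (w * xᵖ) else 0#)
      if-factor true  w = refl
      if-factor false w = trans (*-congˡ (zeroˡ xᵖ)) (zeroʳ _)

    cycleTerm-split : ∀ s → cycleTerm s ≈ emptyTerm s + sumL R (map (λ j → sizedTerm j s) (map suc (upTo (N / 2))))
    cycleTerm-split s = trans (sym (cycleTerm-closedForm s)) (split s)
      where
      split : ∀ s → (if cyclicAdmissible s then matchingTerm ∣ s ∣ s else 0#)
                    ≈ emptyTerm s + sumL R (map (λ j → sizedTerm j s) (map suc (upTo (N / 2))))
      split s rewrite isMatchingᵇ≡cyclicAdmissible s with cyclicAdmissible s in ok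
      ... | false = sym (trans (+-cong (reflexive (Bool.if-eta (does (∣ s ∣ ℕ.≟ 0)))) (sumL-0 (map suc (upTo (N / 2))) (λ _ → refl)))
                               (+-identityʳ 0#))
      ... | true  = sym (select-decomposition (N / 2) ∣ s ∣ (λ j → matchingTerm j s) (cyclicAdmissible⇒∣s∣≤N/2 s ok))

  matchingPolynomial≈sumSubset-cycleTerm :
    pow R x N + sumL R (map (λ j → sgn R j * (a2k R f N φ j * pow R x (N ℕ.∸ 2 ℕ.* j))) (map suc (upTo (N / 2))))
      ≈ sumSubset N cycleTerm
  matchingPolynomial≈sumSubset-cycleTerm = begin
    pow R x N + sumL R (map (λ j → sgn R j * (a2k R f N φ j * pow R x (N ℕ.∸ 2 ℕ.* j))) js)
      ≈⟨ +-cong (sym empty) (trans (sumL-cong js coefficient≈sumSubset) (sumL-sumSubset N js sizedTerm)) ⟩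
    sumSubset N emptyTerm + sumSubset N (λ s → sumL R (map (λ j → sizedTerm j s) js))
      ≈⟨ sumSubset-+ N emptyTerm (λ s → sumL R (map (λ j → sizedTerm j s) js)) ⟨
    sumSubset N (λ s → emptyTerm s + sumL R (map (λ j → sizedTerm j s) js))
      ≈⟨ sumSubset-cong N (λ s → sym (cycleTerm-split s)) ⟩
    sumSubset N cycleTerm ∎
    where
    js = map suc (upTo (N / 2))
    empty : sumSubset N emptyTerm ≈ pow R x N
    empty = begin
      sumSubset N emptyTerm
        ≈⟨ sumSubset-empty N (λ s → if cyclicAdmissible s then matchingTerm 0 s else 0#) ⟩
      (if admissible false false (replicate K false) then matchingTerm 0 (replicate N false) else 0#)
        ≡⟨ ≡.cong (λ b → if b then matchingTerm 0 (replicate N false) else 0#) (admissible-empty K) ⟩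
      1# * (matchingWeight (replicate N false) * pow R x N)
        ≈⟨ *-identityˡ _ ⟩
      matchingWeight (replicate N false) * pow R x N
        ≈⟨ *-congʳ (trans (matchingWeight≈weight (replicate N false)) (weight-empty N g)) ⟩
      1# * pow R x N
        ≈⟨ *-identityˡ _ ⟩
      pow R x N ∎

  sumSubset-cycleTerm : sumSubset N cycleTerm ≈ continuant x (λ i → g (suc i)) N - g 0 * continuant x (λ i → g (suc (suc i))) (suc k)
  sumSubset-cycleTerm = begin
    sumSubset K (λ t → 1# * pathTerm false false g′ t) + sumSubset K (λ t → - g 0 * pathTerm true true g′ t)
      ≈⟨ +-cong (trans (sym (sumSubset-*ˡ K 1# (pathTerm false false g′))) (*-identityˡ _))
                (sym (sumSubset-*ˡ K (- g 0) (pathTerm true true g′))) ⟩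
    sumSubset K (pathTerm false false g′) + - g 0 * (sumSubset (suc k) (λ t → 1# * pathTerm false true g″ t) + sumSubset (suc k) (λ _ → 0#))
      ≈⟨ +-cong (sumSubset-pathTerm-ff K g′)
                (*-congˡ (trans (+-cong (trans (sym (sumSubset-*ˡ (suc k) 1# (pathTerm false true g″))) (*-identityˡ _))
                                        (sumSubset-0 (suc k) (λ _ → refl)))
                                (+-identityʳ _))) ⟩
    continuant x g′ N + - g 0 * sumSubset (suc k) (pathTerm false true g″)
      ≈⟨ +-congˡ (*-congˡ (sumSubset-pathTerm-ft (suc k) g″)) ⟩
    continuant x g′ N + - g 0 * continuant x g″ (suc k)
      ≈⟨ +-congˡ (-‿distribˡ-* (g 0) _) ⟨
    continuant x g′ N - g 0 * continuant x g″ (suc k) ∎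
    where
    g′ = λ i → g (suc i)
    g″ = λ i → g (suc (suc i))

module NonzeroProducts {c ℓ} (R : CommutativeRing c ℓ) (F : IsField R) where
  open CommutativeRing R hiding (zero)
  open import Relation.Binary.Reasoning.Setoid setoid
  open IsField F

  *-nonzero : ∀ {a b} → ¬ a ≈ 0# → ¬ b ≈ 0# → ¬ a * b ≈ 0#
  *-nonzero {a} {b} a≉0 b≉0 ab≈0 with inverse a a≉0
  ... | a⁻¹ , aa⁻¹≈1 = b≉0 (begin
    b              ≈⟨ *-identityˡ b ⟨
    1# * b         ≈⟨ *-congʳ aa⁻¹≈1 ⟨
    (a * a⁻¹) * b  ≈⟨ *-congʳ (*-comm a a⁻¹) ⟩
    (a⁻¹ * a) * b  ≈⟨ *-assoc a⁻¹ a b ⟩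
    a⁻¹ * (a * b)  ≈⟨ *-congˡ ab≈0 ⟩
    a⁻¹ * 0#       ≈⟨ zeroʳ a⁻¹ ⟩
    0#             ∎)

  prodFin-nonzero : ∀ n {h : Fin n → Carrier} → (∀ i → ¬ h i ≈ 0#) → ¬ prodFin R n h ≈ 0#
  prodFin-nonzero zero    _     1≈0 = 0≉1 (sym 1≈0)
  prodFin-nonzero (suc n) h≉0 = *-nonzero (h≉0 zero) (prodFin-nonzero n (λ i → h≉0 (suc i)))

module AntiInvolutionProducts {c ℓ} (R : CommutativeRing c ℓ) (F : IsField R)
                              (f : CommutativeRing.Carrier R → CommutativeRing.Carrier R) (A : IsAntiInvolution R f) where
  open CommutativeRing R hiding (zero)
  open import Relation.Binary.Reasoning.Setoid setoid
  open NonzeroProducts R F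
  open IsAntiInvolution A

  f-* : ∀ {a b} → ¬ a ≈ 0# → ¬ b ≈ 0# → f (a * b) ≈ f a * f b
  f-* {a} {b} a≉0 b≉0 = trans (anti a b a≉0 b≉0) (*-comm (f b) (f a))

  f-prodFin : ∀ n {h : Fin (suc n) → Carrier} → (∀ i → ¬ h i ≈ 0#) →
    f (prodFin R (suc n) h) ≈ prodFin R (suc n) (λ i → f (h i))
  f-prodFin zero    {h} h≉0 = trans (cong _ _ (*-nonzero (h≉0 zero) (λ 1≈0 → 0≉1 (sym 1≈0))) (*-identityʳ (h zero)))
                                    (sym (*-identityʳ _))
    where open IsField F using (0≉1)
  f-prodFin (suc n) {h} h≉0 = trans (f-* (h≉0 zero) (prodFin-nonzero (suc n) (λ i → h≉0 (suc i))))
                                    (*-congˡ (f-prodFin n (λ i → h≉0 (suc i))))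

module SkewGainCycle {c ℓ} (R : CommutativeRing c ℓ) (F : IsField R)
  (f : CommutativeRing.Carrier R → CommutativeRing.Carrier R) (A : IsAntiInvolution R f) (k : ℕ)
  (φ : Fin (suc (suc (suc k))) → Fin (suc (suc (suc k))) → CommutativeRing.Carrier R)
  (skew : IsSkewGainCycle R f (suc (suc (suc k))) φ) (x : CommutativeRing.Carrier R) where
  open CommutativeRing R hiding (zero)
  open import Relation.Binary.Reasoning.Setoid setoid
  open IntegerCoefficients R using (solve; _:=_; _:+_; _:*_; :-_; _:-_; con)
  open FiniteSums R
  open NonzeroProducts R F
  open AntiInvolutionProducts R F f A
  open Determinant R using (det-cyclic; continuant; continuant-cong; continuant-recurrenceʳ)
  open CycleIndexing k
  open CyclicAdjacencyMatrix R k x φ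
  open CycleMatchingPolynomial R k x f φ using (g)

  e e′ : ℕ → Carrier
  e  i = φ (ι i) (next (ι i))
  e′ i = φ (next (ι i)) (ι i)

  e≉0 : ∀ i → ¬ e i ≈ 0#
  e≉0 i = proj₁ (skew (ι i) (next (ι i)) (adj-next (ι i)))

  e′≈f-e : ∀ i → e′ i ≈ f (e i)
  e′≈f-e i = proj₂ (skew (ι i) (next (ι i)) (adj-next (ι i)))

  u*l≈g : ∀ i → u i * l i ≈ g i
  u*l≈g i = trans (solve 2 (λ a b → (:- a) :* (:- b) := a :* b) refl (e i) (e′ i)) (*-congˡ (e′≈f-e i))

  Πe Πe′ : Carrier
  Πe  = prodFin R (suc k) (λ i → e (suc (toℕ i)))
  Πe′ = prodFin R (suc k) (λ i → e′ (suc (toℕ i)))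

  φC-split : φC R N φ ≈ e 0 * (Πe * e K)
  φC-split = begin
    φC R N φ
      ≈⟨ prodFin-cong N (λ i → reflexive (≡.cong (λ a → φ a (next a)) (≡.sym (ι-toℕ i)))) ⟩
    e 0 * prodFin R K (λ i → e (suc (toℕ i)))
      ≈⟨ *-congˡ (prodFin-last (suc k) (λ i → e (suc (toℕ i)))) ⟩
    e 0 * (prodFin R (suc k) (λ i → e (suc (toℕ (inject₁ i)))) * e (suc (toℕ (fromℕ (suc k)))))
      ≈⟨ *-congˡ (*-cong (prodFin-cong (suc k) (λ i → reflexive (≡.cong (λ t → e (suc t)) (Fin.toℕ-inject₁ i))))
                         (reflexive (≡.cong (λ t → e (suc t)) (Fin.toℕ-fromℕ (suc k))))) ⟩
    e 0 * (Πe * e K) ∎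

  f-φC-split : f (φC R N φ) ≈ e′ 0 * (Πe′ * e′ K)
  f-φC-split = begin
    f (φC R N φ)             ≈⟨ cong _ _ (λ φC≈0 → e0Πe-eK≉0 (trans (sym φC-split) φC≈0)) φC-split ⟩
    f (e 0 * (Πe * e K))     ≈⟨ f-* (e≉0 0) (*-nonzero Πe≉0 (e≉0 K)) ⟩
    f (e 0) * f (Πe * e K)   ≈⟨ *-congˡ (f-* Πe≉0 (e≉0 K)) ⟩
    f (e 0) * (f Πe * f (e K))
      ≈⟨ *-cong (sym (e′≈f-e 0)) (*-cong (trans (f-prodFin k (λ i → e≉0 (suc (toℕ i))))
                                                (prodFin-cong (suc k) (λ i → sym (e′≈f-e (suc (toℕ i))))))
                                         (sym (e′≈f-e K))) ⟩
    e′ 0 * (Πe′ * e′ K)      ∎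
    where
    open IsAntiInvolution A using (cong)
    Πe≉0 : ¬ Πe ≈ 0#
    Πe≉0 = prodFin-nonzero (suc k) (λ i → e≉0 (suc (toℕ i)))
    e0Πe-eK≉0 : ¬ e 0 * (Πe * e K) ≈ 0#
    e0Πe-eK≉0 = *-nonzero (e≉0 0) (*-nonzero Πe≉0 (e≉0 K))

  cycleGains : u 0 * prodFin R (suc k) (λ i → u (suc (toℕ i))) * u K + l K * prodFin R (suc k) (λ i → l (suc (toℕ i))) * l 0
    ≈ sgn R (suc k) * (φC R N φ + f (φC R N φ))
  cycleGains = begin
    u 0 * prodFin R (suc k) (λ i → - e (suc (toℕ i))) * u K + l K * prodFin R (suc k) (λ i → - e′ (suc (toℕ i))) * l 0
      ≈⟨ +-cong (*-congʳ (*-congˡ (prodFin-neg (suc k) (λ i → e (suc (toℕ i))))))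
                (*-congʳ (*-congˡ (prodFin-neg (suc k) (λ i → e′ (suc (toℕ i)))))) ⟩
    (- e 0) * (s * Πe) * (- e K) + (- e′ K) * (s * Πe′) * (- e′ 0)
      ≈⟨ solve 7 (λ a p b a′ p′ b′ s → (:- a) :* (s :* p) :* (:- b) :+ (:- b′) :* (s :* p′) :* (:- a′)
                                     := s :* (a :* (p :* b) :+ a′ :* (p′ :* b′)))
               refl (e 0) Πe (e K) (e′ 0) Πe′ (e′ K) s ⟩
    s * (e 0 * (Πe * e K) + e′ 0 * (Πe′ * e′ K))
      ≈⟨ *-congˡ (+-cong φC-split f-φC-split) ⟨
    s * (φC R N φ + f (φC R N φ)) ∎
    where s = sgn R (suc k)

  Ψ≈continuants : Ψ R N φ x ≈
    continuant x (λ i → g (suc i)) N - g 0 * continuant x (λ i → g (suc (suc i))) (suc k) - (φC R N φ + f (φC R N φ))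
  Ψ≈continuants = begin
    Ψ R N φ x
      ≈⟨ Ψ≈det-cyclic ⟩
    det R N (λ a b → C (toℕ a) (toℕ b))
      ≈⟨ det-cyclic k x u l (l K) (u K) ⟩
    x * continuant x (λ i → u (suc i) * l (suc i)) K
      - u 0 * l 0 * continuant x (λ i → u (suc (suc i)) * l (suc (suc i))) (suc k)
      - l K * u K * continuant x (λ i → u (suc i) * l (suc i)) (suc k)
      + sgn R K * (u 0 * prodFin R (suc k) (λ i → u (suc (toℕ i))) * u K + l K * prodFin R (suc k) (λ i → l (suc (toℕ i))) * l 0)
      ≈⟨ +-cong (+-cong (+-cong (*-congˡ (continuant-cong x K (λ i → u*l≈g (suc i))))
                                (-‿cong (*-cong (u*l≈g 0) (continuant-cong x (suc k) (λ i → u*l≈g (suc (suc i)))))))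
                        (-‿cong (*-cong (trans (*-comm (l K) (u K)) (u*l≈g K)) (continuant-cong x (suc k) (λ i → u*l≈g (suc i))))))
                (*-congˡ cycleGains) ⟩
    x * continuant x g′ K - g 0 * P″ - g K * continuant x g′ (suc k) + (- 1# * s) * (s * Φ)
      ≈⟨ solve 8 (λ x A g₀ P gₖ B s Φ → x :* A :- g₀ :* P :- gₖ :* B :+ (:- con (+ 1) :* s) :* (s :* Φ)
                                      := (x :* A :- gₖ :* B) :- g₀ :* P :- (s :* s) :* Φ)
               refl x (continuant x g′ K) (g 0) P″ (g K) (continuant x g′ (suc k)) s Φ ⟩
    (x * continuant x g′ K - g K * continuant x g′ (suc k)) - g 0 * P″ - (s * s) * Φ
      ≈⟨ +-cong (+-congʳ (sym (continuant-recurrenceʳ x (suc k) g′)))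
                (-‿cong (trans (*-congʳ (sgn-square (suc k))) (*-identityˡ Φ))) ⟩
    continuant x g′ N - g 0 * P″ - Φ ∎
    where
    s  = sgn R (suc k)
    Φ  = φC R N φ + f (φC R N φ)
    g′ = λ i → g (suc i)
    P″ = continuant x (λ i → g (suc (suc i))) (suc k)

corollary2p3 : ∀ {c ℓ : Level} (F : CommutativeRing c ℓ) → IsField F → CharZero F
    → (f : CommutativeRing.Carrier F → CommutativeRing.Carrier F) → IsAntiInvolution F f
    → (n : ℕ) → 3 ≤ n
    → (φ : Fin n → Fin n → CommutativeRing.Carrier F) → IsSkewGainCycle F f n φ
    → (x : CommutativeRing.Carrier F)
    → CommutativeRing._≈_ F (Ψ F n φ x) (cycleFormula F f n φ x)
corollary2p3 F isField _ f anti (suc (suc (suc k))) (s≤s (s≤s (s≤s z≤n))) φ skew x = begin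
  Ψ F N φ x
    ≈⟨ Ψ≈continuants ⟩
  continuant x (λ i → g (suc i)) N - g 0 * continuant x (λ i → g (suc (suc i))) (suc k) - (φC F N φ + f (φC F N φ))
    ≈⟨ +-congʳ (sym (trans matchingPolynomial≈sumSubset-cycleTerm sumSubset-cycleTerm)) ⟩
  cycleFormula F f N φ x ∎
  where
  open CommutativeRing F
  open import Relation.Binary.Reasoning.Setoid setoid
  open CycleIndexing k using (N)
  open Determinant F using (continuant)
  open CycleMatchingPolynomial F k x f φ using (g; matchingPolynomial≈sumSubset-cycleTerm; sumSubset-cycleTerm)
  open SkewGainCycle F isField f anti k φ skew x using (Ψ≈continuants)
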